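{- Let $q$ be a prime power, $m,k,n$ positive integers with $k<n$, and $h$ an integer with $0\le h<k$. Let $\mathcal{C}$ be a nondegenerate $[n,k]_{q^m/q}$ code and $\mathcal{U}$ an $[n,k]_{q^m/q}$ system associated with $\mathcal{C}$. Then $\mathcal{U}$ is $h$-scattered if and only if $\mathrm{Rdef}(\mathcal{C}^\perp)\le\lfloor\frac{km}{n}\rfloor-h-1$.
   Context: An $[n,k]_{q^m/q}$ code is a $k$-dimensional $\mathbb{F}_{q^m}$-subspace of $\mathbb{F}_{q^m}^n$; rank weight of a vector is the $\mathbb{F}_q$-dimension of the $\mathbb{F}_q$-span of its entries; $d_{\mathrm{rk}}(\mathcal{C})$ is the least rank weight of a nonzero codeword. Dual: $\mathcal{C}^\perp=\{v: cv^\top=0\ \forall c\in\mathcal{C}\}$. $\mathcal{C}$ is nondegenerate if the $\mathbb{F}_q$-span of the columns $g_1,\dots,g_n\in\mathbb{F}_{q^m}^k$ of a generator matrix $G$ (rows spanning $\mathcal{C}$) has $\mathbb{F}_q$-dimension $n$; the systems associated with $\mathcal{C}$ are then $\langle g_1,\dots,g_n\rangle_{\mathbb{F}_q}M$, $M\in\mathrm{GL}(k,q^m)$. An $[n,k]_{q^m/q}$ system is an $n$-dimensional $\mathbb{F}_q$-subspace of $\mathbb{F}_{q^m}^k$ spanning it over $\mathbb{F}_{q^m}$; it is $h$-scattered if it meets every $h$-dimensional $\mathbb{F}_{q^m}$-subspace of $\mathbb{F}_{q^m}^k$ in an $\mathbb{F}_q$-subspace of dimension at most $h$. The Singleton rank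 defect of an $[N,K,d]_{q^m/q}$ code $\mathcal{D}$ is $\mathrm{Rdef}(\mathcal{D})=m-\lceil\frac{Km}{N}\rceil-d+1$. -}

module Defs where

open import Data.Nat using (ℕ; zero; suc; _≤_; _<_; _∸_; _^_; NonZero)
import Data.Nat as ℕ
open import Data.Nat.DivMod using (_/_)
open import Data.Nat.Primality using (Prime)
open import Data.Fin using (Fin; zero; suc)
open import Data.Product using (Σ; ∃; _×_; _,_)
open import Data.Integer using (ℤ; +_) renaming (_+_ to _+ℤ_; _-_ to _-ℤ_)
open import Relation.Binary.PropositionalEquality using (_≡_; _≢_; _≗_)
open import Relation.Nullary using (¬_)
open import Algebra.Core using (Op₁; Op₂)
import Algebra.Structures
import Data.Fin as Fin
open import Relation.Nullary using (yes; no)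
open import Function.Bundles using (_↔_)

IsPrimePower : ℕ → Set
IsPrimePower q = ∃ λ p → Prime p × ∃ λ e → 1 ≤ e × q ≡ p ^ e

record Field : Set₁ where
  infixl 6 _+_
  infixl 7 _*_
  field
    Carrier : Set
    _+_ _*_ : Op₂ Carrier
    -_      : Op₁ Carrier
    0# 1#   : Carrier
    isCommutativeRing :
      Algebra.Structures.IsCommutativeRing {A = Carrier} _≡_ _+_ _*_ -_ 0# 1#
    0≢1     : 0# ≢ 1#
    inverse : ∀ x → x ≢ 0# → ∃ λ y → x * y ≡ 1#

HasSize : Set → ℕ → Set
HasSize A N = A ↔ Fin N

-- A field extension L / F, given by a field homomorphism ι : F → L
-- (field homomorphisms are injective, so F is identified with the
-- subfield ι(F) of L).
record FieldExtension : Set₁ where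
  field
    Base Top : Field
  module F = Field Base
  module L = Field Top
  field
    ι     : F.Carrier → L.Carrier
    ι-1   : ι F.1# ≡ L.1#
    ι-+   : ∀ x y → ι (x F.+ y) ≡ ι x L.+ ι y
    ι-*   : ∀ x y → ι (x F.* y) ≡ ι x L.* ι y

-- Linear algebra over L and over the subfield F (written K = F_q below)

module Ext (E : FieldExtension) where
  open FieldExtension E
  open L

  Vec : ℕ → Set
  Vec n = Fin n → Carrier

  Mat : ℕ → ℕ → Set
  Mat r c = Fin r → Fin c → Carrier

  ∑ : ∀ {n} → (Fin n → Carrier) → Carrier
  ∑ {zero}  f = 0#
  ∑ {suc n} f = f zero + ∑ (λ i → f (suc i))

  0v : ∀ {n} → Vec n
  0v _ = 0#

  lc : ∀ {r n} → (Fin r → Carrier) → (Fin r → Vec n) → Vec n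
  lc c b j = ∑ (λ i → c i * b i j)

  LSpan : ∀ {r n} → (Fin r → Vec n) → Vec n → Set
  LSpan {r} b x = ∃ λ (c : Fin r → Carrier) → x ≗ lc c b
  KSpan : ∀ {r n} → (Fin r → Vec n) → Vec n → Set
  KSpan {r} b x = ∃ λ (a : Fin r → F.Carrier) → x ≗ lc (λ i → ι (a i)) b

  LIndep : ∀ {r n} → (Fin r → Vec n) → Set
  LIndep {r} b = ∀ (c : Fin r → Carrier) → lc c b ≗ 0v → ∀ i → c i ≡ 0#
  KIndep : ∀ {r n} → (Fin r → Vec n) → Set
  KIndep {r} b =
    ∀ (a : Fin r → F.Carrier) → lc (λ i → ι (a i)) b ≗ 0v → ∀ i → a i ≡ F.0#

  LDim : ∀ {n} → (Vec n → Set) → ℕ → Set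
  LDim {n} S d = ∃ λ (b : Fin d → Vec n) →
    (∀ i → S (b i)) × LIndep b × (∀ x → S x → LSpan b x)

  KDim : ∀ {n} → (Vec n → Set) → ℕ → Set
  KDim {n} S d = ∃ λ (b : Fin d → Vec n) →
    (∀ i → S (b i)) × KIndep b × (∀ x → S x → KSpan b x)

  RankWeight : ∀ {n} → Vec n → ℕ → Set
  RankWeight v r = KDim (KSpan (λ i (_ : Fin 1) → v i)) r

  MinRankDist : ∀ {n} → (Vec n → Set) → ℕ → Set
  MinRankDist D d =
    (∃ λ v → D v × ¬ (v ≗ 0v) × RankWeight v d) ×
    (∀ v r → D v → ¬ (v ≗ 0v) → RankWeight v r → d ≤ r)

  Dual : ∀ {n} → (Vec n → Set) → Vec n → Set
  Dual C v = ∀ c → C c → ∑ (λ j → c j * v j) ≡ 0#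

  _·_ : ∀ {a b c} → Mat a b → Mat b c → Mat a c
  (A · B) i j = ∑ (λ l → A i l * B l j)

  I : ∀ {k} → Mat k k
  I i j with i Fin.≟ j
  ... | yes _ = 1#
  ... | no  _ = 0#

  Invertible : ∀ {k} → Mat k k → Set
  Invertible M = ∃ λ M' → (∀ i j → (M · M') i j ≡ I i j) ×
                          (∀ i j → (M' · M) i j ≡ I i j)

  _ᵥ*_ : ∀ {k c} → Vec k → Mat k c → Vec c
  (u ᵥ* M) j = ∑ (λ i → u i * M i j)

  columns : ∀ {k n} → Mat k n → Fin n → Vec k
  columns G j i = G i j

  CodeOf : ∀ {k n} → Mat k n → Vec n → Set
  CodeOf G = LSpan G

  SystemOf : ∀ {k n} → Mat k n → Mat k k → Vec k → Set
  SystemOf G M x = ∃ λ u → KSpan (columns G) u × x ≗ (u ᵥ* M)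

  -- U is h-scattered: for every h-dimensional L-subspace W of L^k
  -- (given by an L-linearly independent family w of size h spanning it),
  -- U ∩ W has F-dimension at most h.
  HScattered : ∀ {k} → (Vec k → Set) → ℕ → Set
  HScattered {k} U h = ∀ (w : Fin h → Vec k) → LIndep w →
    ∃ λ d → KDim (λ x → U x × LSpan w x) d × d ≤ h

ceilDiv : (a N : ℕ) → .{{NonZero N}} → ℕ
ceilDiv a N = (a ℕ.+ (N ∸ 1)) / N

Rdef : (m N K d : ℕ) → .{{NonZero N}} → ℤ
Rdef m N K d = (+ m -ℤ + ceilDiv (K ℕ.* m) N) -ℤ + d +ℤ + 1

module Submission where

-- Write U = ⟨g₁,…,gₙ⟩_F M. A point (Σⱼ aⱼ gⱼ) M of U, aⱼ ∈ F, has the coordinate vector a ∈ Fⁿ.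
-- h + 1 F-independent points xᵢ of U in an h-dimensional W are L-dependent, and a relation
-- Σᵢ cᵢ xᵢ = 0 turns into the nonzero codeword Σᵢ cᵢ aᵢ of C⊥, whose entries lie in the F-span of
-- the cᵢ, so its rank weight is at most h + 1. Conversely, a codeword of rank weight D
-- gives D F-independent but L-dependent points of U; an L-basis of their span, completed by columns
-- gⱼ M to an h-dimensional W (U spans L^k), puts more than h F-independent points into U ∩ W when
-- D ≤ h + 1. So U is h-scattered iff d(C⊥) ≥ h + 2. Finally dim C⊥ = n − k and
-- ⌈(n − k) m / n⌉ = m − ⌊k m / n⌋ turn the defect inequality into exactly d(C⊥) ≥ h + 2.

open import Defs
open import Relation.Binary.PropositionalEquality using (_≡_)

module FieldProperties (R : Field) where

  open import Algebra.Bundles using (CommutativeRing)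
  import Algebra.Properties.CommutativeSemigroup as CommutativeSemigroupProperties
  import Algebra.Properties.Ring as RingProperties
  import Algebra.Properties.Semiring.Sum as SemiringSum
  open import Data.Empty using (⊥-elim)
  import Data.Fin as Fin
  open import Data.Fin using (Fin; punchIn)
  open import Data.Fin.Properties using (punchInᵢ≢i)
  open import Data.Nat using (suc)
  open import Data.Product using (proj₁; proj₂)
  open import Relation.Binary.PropositionalEquality
  open import Relation.Nullary using (yes; no)
  open Field R

  commutativeRing : CommutativeRing _ _
  commutativeRing = record { isCommutativeRing = isCommutativeRing }

  open CommutativeRing commutativeRing public
    using ( +-assoc; +-comm; +-identityˡ; +-identityʳ; -‿inverseˡ; -‿inverseʳ
          ; *-assoc; *-comm; *-identityˡ; *-identityʳ; distribˡ; distribʳ; zeroˡ; zeroʳ )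
  open RingProperties (CommutativeRing.ring commutativeRing) public
    using ( -‿distribˡ-*; -‿distribʳ-*; -‿+-comm
          ; +-inverseˡ-unique; +-inverseʳ-unique; x∙y⁻¹≈ε⇒x≈y; x+x≈x⇒x≈0 )
  open CommutativeSemigroupProperties (CommutativeRing.+-commutativeSemigroup commutativeRing) public
    using () renaming (interchange to +-interchange; x∙yz≈y∙xz to +-leftComm)
  open CommutativeSemigroupProperties (CommutativeRing.*-commutativeSemigroup commutativeRing) public
    using () renaming (x∙yz≈y∙xz to *-leftComm)

  infixl 6 _-_
  _-_ : Carrier → Carrier → Carrier
  x - y = x + - y

  inv : ∀ x → x ≢ 0# → Carrier
  inv x x≢0 = proj₁ (inverse x x≢0)

  inverseʳ : ∀ x (x≢0 : x ≢ 0#) → x * inv x x≢0 ≡ 1#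
  inverseʳ x x≢0 = proj₂ (inverse x x≢0)

  inverseˡ : ∀ x (x≢0 : x ≢ 0#) → inv x x≢0 * x ≡ 1#
  inverseˡ x x≢0 = trans (*-comm _ x) (inverseʳ x x≢0)

  *-cancel-inv : ∀ x (x≢0 : x ≢ 0#) y → x * (inv x x≢0 * y) ≡ y
  *-cancel-inv x x≢0 y = trans (sym (*-assoc x _ y)) (trans (cong (_* y) (inverseʳ x x≢0)) (*-identityˡ y))

  inv-cancel-* : ∀ x (x≢0 : x ≢ 0#) y → inv x x≢0 * (x * y) ≡ y
  inv-cancel-* x x≢0 y = trans (*-leftComm _ x y) (*-cancel-inv x x≢0 y)

  -- subtracting t times the row (g, y) from the row (t g, x) clears the leading entry
  eliminate : ∀ t g w x y → ((t * g) * w + x) - t * (g * w + y) ≡ x - t * y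
  eliminate t g w x y = begin
    (t * g * w + x) - t * (g * w + y)          ≡⟨ cong (λ z → (t * g * w + x) - z) (trans (distribˡ t (g * w) y) (cong (_+ t * y) (sym (*-assoc t g w)))) ⟩
    (t * g * w + x) + - (t * g * w + t * y)    ≡⟨ cong ((t * g * w + x) +_) (sym (-‿+-comm (t * g * w) (t * y))) ⟩
    (t * g * w + x) + (- (t * g * w) + - (t * y)) ≡⟨ +-interchange (t * g * w) x _ _ ⟩
    (t * g * w - t * g * w) + (x - t * y)      ≡⟨ cong (_+ (x - t * y)) (-‿inverseʳ (t * g * w)) ⟩
    0# + (x - t * y)                           ≡⟨ +-identityˡ _ ⟩
    x - t * y                                  ∎
    where open ≡-Reasoning

  1≢0 : 1# ≢ 0#
  1≢0 e = 0≢1 (sym e)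

  δ : ∀ {n} → Fin n → Fin n → Carrier
  δ i j with i Fin.≟ j
  ... | yes _ = 1#
  ... | no  _ = 0#

  δ-diag : ∀ {n} (i : Fin n) → δ i i ≡ 1#
  δ-diag i with i Fin.≟ i
  ... | yes _ = refl
  ... | no i≢i = ⊥-elim (i≢i refl)

  δ-punchIn : ∀ {n} (i : Fin (suc n)) j → δ i (punchIn i j) ≡ 0#
  δ-punchIn i j with i Fin.≟ punchIn i j
  ... | yes e = ⊥-elim (punchInᵢ≢i i j (sym e))
  ... | no  _ = refl

  δ-sym : ∀ {n} (i j : Fin n) → δ i j ≡ δ j i
  δ-sym i j with i Fin.≟ j | j Fin.≟ i
  ... | yes _ | yes _ = refl
  ... | yes e | no ne = ⊥-elim (ne (sym e))
  ... | no ne | yes e = ⊥-elim (ne (sym e))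
  ... | no _  | no _  = refl

  module Sum where
    open SemiringSum (CommutativeRing.semiring commutativeRing) public
      using (sum; sum-cong-≗; sum-replicate-zero; ∑-distrib-+; ∑-comm; *-distribˡ-sum; *-distribʳ-sum; sum-remove)

    sum-0 : ∀ {n} {f : Fin n → Carrier} → (∀ i → f i ≡ 0#) → sum f ≡ 0#
    sum-0 {n} f≗0 = trans (sum-cong-≗ f≗0) (sum-replicate-zero n)

    sum-neg : ∀ {n} (f : Fin n → Carrier) → - sum f ≡ sum (λ i → - f i)
    sum-neg f = sym (+-inverseʳ-unique (sum f) _ (trans (sym (∑-distrib-+ f _)) (sum-0 (λ i → -‿inverseʳ (f i)))))

    sum-δ : ∀ {n} (p : Fin n) (f : Fin n → Carrier) → sum (λ i → δ p i * f i) ≡ f p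
    sum-δ {suc n} p f = begin
      sum (λ i → δ p i * f i)                                 ≡⟨ sum-remove {i = p} (λ i → δ p i * f i) ⟩
      δ p p * f p + sum (λ j → δ p (punchIn p j) * f (punchIn p j))
        ≡⟨ cong₂ _+_ (cong (_* f p) (δ-diag p)) (sum-0 (λ j → trans (cong (_* _) (δ-punchIn p j)) (zeroˡ _))) ⟩
      1# * f p + 0#                                           ≡⟨ trans (+-identityʳ _) (*-identityˡ _) ⟩
      f p                                                     ∎
      where open ≡-Reasoning

    left-inverse⇒injective : ∀ {m r} (A : Fin m → Fin r → Carrier) (B : Fin r → Fin m → Carrier) →
                             (∀ l i → sum (λ j → B l j * A j i) ≡ δ l i) →
                             ∀ α → (∀ j → sum (λ i → α i * A j i) ≡ 0#) → ∀ l → α l ≡ 0#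
    left-inverse⇒injective A B BA≡I α Aα≡0 l = begin
      α l                                          ≡⟨ sym (sum-δ l α) ⟩
      sum (λ i → δ l i * α i)                      ≡⟨ sum-cong-≗ (λ i → cong (_* α i) (sym (BA≡I l i))) ⟩
      sum (λ i → sum (λ j → B l j * A j i) * α i)  ≡⟨ sum-cong-≗ (λ i → *-distribʳ-sum (α i) (λ j → B l j * A j i)) ⟩
      sum (λ i → sum (λ j → B l j * A j i * α i))  ≡⟨ ∑-comm (λ i j → B l j * A j i * α i) ⟩
      sum (λ j → sum (λ i → B l j * A j i * α i))  ≡⟨ sum-cong-≗ (λ j → sum-cong-≗ (λ i → trans (*-assoc (B l j) (A j i) (α i)) (cong (B l j *_) (*-comm (A j i) (α i))))) ⟩
      sum (λ j → sum (λ i → B l j * (α i * A j i))) ≡⟨ sum-cong-≗ (λ j → sym (*-distribˡ-sum (B l j) (λ i → α i * A j i))) ⟩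
      sum (λ j → B l j * sum (λ i → α i * A j i))  ≡⟨ sum-0 (λ j → trans (cong (B l j *_) (Aα≡0 j)) (zeroʳ (B l j))) ⟩
      0#                                           ∎
      where open ≡-Reasoning

module Finiteness where

  import Data.Fin as Fin
  open import Data.Fin using (Fin; zero; suc)
  open import Data.Fin.Properties using (all?)
  open import Data.List using (List; []; _∷_; map; concatMap; allFin)
  open import Data.List.Membership.Propositional using (_∈_)
  open import Data.List.Membership.Propositional.Properties using (∈-map⁺; ∈-allFin; ∈-concatMap⁺)
  open import Data.List.Relation.Unary.Any as Any using (here; any?)
  open import Data.Nat using (zero; suc)
  open import Data.Product using (∃; _×_; _,_)
  open import Data.Vec.Functional using (head; tail) renaming (_∷_ to _∷ᶠ_)
  open import Function using (_∘_; Inverse)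
  open import Relation.Binary.Definitions using (DecidableEquality; _Respects_)
  open import Relation.Binary.PropositionalEquality
  open import Relation.Nullary using (Dec; yes; no)
  open import Relation.Unary using (Decidable)

  record Finite (A : Set) : Set where
    field
      elements : List A
      complete : ∀ x → x ∈ elements
      _≟_      : DecidableEquality A

  hasSize⇒finite : ∀ {A N} → HasSize A N → Finite A
  hasSize⇒finite {A} {N} A↔Fin = record { elements = map from (allFin N) ; complete = complete ; _≟_ = _≟_ }
    where
    open Inverse A↔Fin
    complete : ∀ x → x ∈ map from (allFin N)
    complete x = subst (_∈ map from (allFin N)) (strictlyInverseʳ x) (∈-map⁺ from (∈-allFin (to x)))
    _≟_ : DecidableEquality A
    x ≟ y with to x Fin.≟ to y
    ... | yes e = yes (trans (sym (strictlyInverseʳ x)) (trans (cong from e) (strictlyInverseʳ y)))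
    ... | no ne = no (ne ∘ cong to)

  module _ {A : Set} (fin : Finite A) where
    open Finite fin

    functions : ∀ r → List (Fin r → A)
    functions zero    = (λ ()) ∷ []
    functions (suc r) = concatMap (λ x → map (x ∷ᶠ_) (functions r)) elements

    functions-complete : ∀ r (f : Fin r → A) → ∃ λ g → g ∈ functions r × g ≗ f
    functions-complete zero    f = (λ ()) , here refl , (λ ())
    functions-complete (suc r) f with functions-complete r (tail f)
    ... | g , g∈ , g≗ = head f ∷ᶠ g
                      , ∈-concatMap⁺ (λ x → map (x ∷ᶠ_) (functions r)) (Any.map (λ { refl → ∈-map⁺ (head f ∷ᶠ_) g∈ }) (complete (head f)))
                      , λ { zero → refl ; (suc i) → g≗ i }

    ∃-function? : ∀ {r} {P : (Fin r → A) → Set} → P Respects _≗_ → Decidable P → Dec (∃ P)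
    ∃-function? {r} resp P? with any? P? (functions r)
    ... | yes p = yes (Any.satisfied p)
    ... | no ¬p = no λ { (f , pf) → let g , g∈ , g≗ = functions-complete r f
                                    in ¬p (Any.map (λ { refl → resp (sym ∘ g≗) pf }) g∈) }

    ≗? : ∀ {n} (u v : Fin n → A) → Dec (u ≗ v)
    ≗? u v = all? (λ i → u i ≟ v i)

module LinearCombinations (E : FieldExtension) where

  import Data.Fin as Fin
  open import Data.Fin using (Fin; zero; suc; punchIn; _↑ˡ_; _↑ʳ_)
  import Data.Nat as ℕ
  open import Data.Nat using (ℕ; zero; suc)
  open import Function using (_∘_)
  open import Relation.Binary.PropositionalEquality
  open import Relation.Nullary using (yes; no)
  open ≡-Reasoning

  open FieldExtension E using (Top)
  open Ext E
  open Field Top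
  open FieldProperties Top
  open FieldProperties.Sum Top renaming (∑-comm to sum-comm; ∑-distrib-+ to sum-distrib-+)

  ∑≡sum : ∀ {n} (f : Fin n → Carrier) → ∑ f ≡ sum f
  ∑≡sum {zero}  f = refl
  ∑≡sum {suc n} f = cong (f zero +_) (∑≡sum (f ∘ suc))

  ∑-cong : ∀ {n} {f g : Fin n → Carrier} → (∀ i → f i ≡ g i) → ∑ f ≡ ∑ g
  ∑-cong {f = f} {g} f≗g = trans (∑≡sum f) (trans (sum-cong-≗ f≗g) (sym (∑≡sum g)))

  ∑-0 : ∀ {n} {f : Fin n → Carrier} → (∀ i → f i ≡ 0#) → ∑ f ≡ 0#
  ∑-0 {f = f} f≗0 = trans (∑≡sum f) (sum-0 f≗0)

  ∑-+ : ∀ {n} (f g : Fin n → Carrier) → ∑ (λ i → f i + g i) ≡ ∑ f + ∑ g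
  ∑-+ f g = trans (∑≡sum (λ i → f i + g i)) (trans (sum-distrib-+ f g) (sym (cong₂ _+_ (∑≡sum f) (∑≡sum g))))

  ∑-*ˡ : ∀ {n} x (f : Fin n → Carrier) → x * ∑ f ≡ ∑ (λ i → x * f i)
  ∑-*ˡ x f = trans (cong (x *_) (∑≡sum f)) (trans (*-distribˡ-sum x f) (sym (∑≡sum (λ i → x * f i))))

  ∑-*ʳ : ∀ {n} x (f : Fin n → Carrier) → ∑ f * x ≡ ∑ (λ i → f i * x)
  ∑-*ʳ x f = trans (cong (_* x) (∑≡sum f)) (trans (*-distribʳ-sum x f) (sym (∑≡sum (λ i → f i * x))))

  ∑-neg : ∀ {n} (f : Fin n → Carrier) → - ∑ f ≡ ∑ (λ i → - f i)
  ∑-neg f = trans (cong -_ (∑≡sum f)) (trans (sum-neg f) (sym (∑≡sum (λ i → - f i))))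

  ∑-comm : ∀ {m n} (f : Fin m → Fin n → Carrier) → ∑ (λ i → ∑ (λ j → f i j)) ≡ ∑ (λ j → ∑ (λ i → f i j))
  ∑-comm f = begin
    ∑ (λ i → ∑ (f i))                    ≡⟨ ∑-cong (λ i → ∑≡sum (f i)) ⟩
    ∑ (λ i → sum (f i))                  ≡⟨ ∑≡sum (λ i → sum (f i)) ⟩
    sum (λ i → sum (f i))                ≡⟨ sum-comm f ⟩
    sum (λ j → sum (λ i → f i j))        ≡⟨ sym (∑≡sum (λ j → sum (λ i → f i j))) ⟩
    ∑ (λ j → sum (λ i → f i j))          ≡⟨ sym (∑-cong (λ j → ∑≡sum (λ i → f i j))) ⟩
    ∑ (λ j → ∑ (λ i → f i j))            ∎

  ∑-remove : ∀ {n} (p : Fin (suc n)) (f : Fin (suc n) → Carrier) → ∑ f ≡ f p + ∑ (f ∘ punchIn p)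
  ∑-remove p f = trans (∑≡sum f) (trans (sum-remove {i = p} f) (cong (f p +_) (sym (∑≡sum (f ∘ punchIn p)))))

  ∑-↑ : ∀ {a b} (f : Fin (a ℕ.+ b) → Carrier) → ∑ f ≡ ∑ (λ i → f (i ↑ˡ b)) + ∑ (λ j → f (a ↑ʳ j))
  ∑-↑ {zero}  f = sym (+-identityˡ _)
  ∑-↑ {suc a} {b} f = trans (cong (f zero +_) (∑-↑ {a} {b} (f ∘ suc))) (sym (+-assoc _ _ _))

  I≡δ : ∀ {k} (i j : Fin k) → I i j ≡ δ i j
  I≡δ i j with i Fin.≟ j
  ... | yes _ = refl
  ... | no  _ = refl

  ∑-δ : ∀ {n} (p : Fin n) (f : Fin n → Carrier) → ∑ (λ i → δ p i * f i) ≡ f p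
  ∑-δ p f = trans (∑≡sum (λ i → δ p i * f i)) (sum-δ p f)

  ∑-δʳ : ∀ {n} (p : Fin n) (f : Fin n → Carrier) → ∑ (λ i → f i * I i p) ≡ f p
  ∑-δʳ p f = trans (∑-cong (λ i → trans (*-comm (f i) _) (cong (_* f i) (trans (I≡δ i p) (δ-sym i p))))) (∑-δ p f)

  lc-cong : ∀ {r n} {c d : Fin r → Carrier} {b b′ : Fin r → Vec n} →
            (∀ i → c i ≡ d i) → (∀ i → b i ≗ b′ i) → lc c b ≗ lc d b′
  lc-cong c≗d b≗b′ j = ∑-cong (λ i → cong₂ _*_ (c≗d i) (b≗b′ i j))

  lc-congˡ : ∀ {r n} {c d : Fin r → Carrier} (b : Fin r → Vec n) → (∀ i → c i ≡ d i) → lc c b ≗ lc d b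
  lc-congˡ b c≗d = lc-cong c≗d (λ _ _ → refl)

  lc-congʳ : ∀ {r n} (c : Fin r → Carrier) {b b′ : Fin r → Vec n} → (∀ i → b i ≗ b′ i) → lc c b ≗ lc c b′
  lc-congʳ c = lc-cong (λ _ → refl)

  lc-+ : ∀ {r n} (c d : Fin r → Carrier) (b : Fin r → Vec n) j →
         lc (λ i → c i + d i) b j ≡ lc c b j + lc d b j
  lc-+ c d b j = trans (∑-cong (λ i → distribʳ (b i j) (c i) (d i))) (∑-+ (λ i → c i * b i j) (λ i → d i * b i j))

  lc-* : ∀ {r n} x (c : Fin r → Carrier) (b : Fin r → Vec n) j →
         lc (λ i → x * c i) b j ≡ x * lc c b j
  lc-* x c b j = trans (∑-cong (λ i → *-assoc x (c i) (b i j))) (sym (∑-*ˡ x (λ i → c i * b i j)))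

  lc-neg : ∀ {r n} (c : Fin r → Carrier) (b : Fin r → Vec n) j →
           lc (λ i → - c i) b j ≡ - lc c b j
  lc-neg c b j = trans (∑-cong (λ i → sym (-‿distribˡ-* (c i) (b i j)))) (sym (∑-neg (λ i → c i * b i j)))

  lc-−* : ∀ {r n} (a b : Fin r → Carrier) x (f : Fin r → Vec n) j →
          lc (λ l → a l - x * b l) f j ≡ lc a f j - x * lc b f j
  lc-−* a b x f j = begin
    lc (λ l → a l - x * b l) f j              ≡⟨ lc-+ a (λ l → - (x * b l)) f j ⟩
    lc a f j + lc (λ l → - (x * b l)) f j     ≡⟨ cong (lc a f j +_) (trans (lc-neg (λ l → x * b l) f j) (cong -_ (lc-* x b f j))) ⟩
    lc a f j - x * lc b f j                   ∎

  lc-zeroˡ : ∀ {r n} {c : Fin r → Carrier} (b : Fin r → Vec n) → (∀ i → c i ≡ 0#) → lc c b ≗ 0v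
  lc-zeroˡ b c≗0 j = ∑-0 (λ i → trans (cong (_* _) (c≗0 i)) (zeroˡ _))

  lc-δ : ∀ {r n} (p : Fin r) (b : Fin r → Vec n) → lc (δ p) b ≗ b p
  lc-δ p b j = ∑-δ p (λ i → b i j)

  lc-tail : ∀ {r n} (c : Fin (suc r) → Carrier) (b : Fin (suc r) → Vec n) → c zero ≡ 0# →
            lc c b ≗ lc (c ∘ suc) (b ∘ suc)
  lc-tail c b c₀≡0 j = trans (cong (λ z → z * b zero j + lc (c ∘ suc) (b ∘ suc) j) c₀≡0)
                             (trans (cong (_+ lc (c ∘ suc) (b ∘ suc) j) (zeroˡ (b zero j))) (+-identityˡ _))

  lc-remove : ∀ {r n} (p : Fin (suc r)) (c : Fin (suc r) → Carrier) (b : Fin (suc r) → Vec n) j →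
              lc c b j ≡ c p * b p j + lc (c ∘ punchIn p) (b ∘ punchIn p) j
  lc-remove p c b j = ∑-remove p (λ i → c i * b i j)

  lc-↑ : ∀ {a b n} (c : Fin (a ℕ.+ b) → Carrier) (f : Fin (a ℕ.+ b) → Vec n) j →
         lc c f j ≡ lc (λ i → c (i ↑ˡ b)) (λ i → f (i ↑ˡ b)) j + lc (λ i → c (a ↑ʳ i)) (λ i → f (a ↑ʳ i)) j
  lc-↑ {a} {b} c f j = ∑-↑ {a} {b} (λ i → c i * f i j)

  lc-lc : ∀ {r s n} (c : Fin r → Carrier) (d : Fin r → Fin s → Carrier) (z : Fin s → Vec n) j →
          lc c (λ i → lc (d i) z) j ≡ lc (λ l → ∑ (λ i → c i * d i l)) z j
  lc-lc {r} {s} c d z j = begin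
    ∑ (λ i → c i * ∑ (λ l → d i l * z l j))        ≡⟨ ∑-cong (λ i → ∑-*ˡ (c i) (λ l → d i l * z l j)) ⟩
    ∑ (λ i → ∑ (λ l → c i * (d i l * z l j)))      ≡⟨ ∑-comm (λ i l → c i * (d i l * z l j)) ⟩
    ∑ (λ l → ∑ (λ i → c i * (d i l * z l j)))      ≡⟨ ∑-cong (λ l → ∑-cong (λ i → sym (*-assoc (c i) (d i l) (z l j)))) ⟩
    ∑ (λ l → ∑ (λ i → (c i * d i l) * z l j))      ≡⟨ ∑-cong (λ l → sym (∑-*ʳ (z l j) (λ i → c i * d i l))) ⟩
    ∑ (λ l → ∑ (λ i → c i * d i l) * z l j)        ∎

  ᵥ*-cong : ∀ {k c} {u u′ : Vec k} (M : Mat k c) → u ≗ u′ → (u ᵥ* M) ≗ (u′ ᵥ* M)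
  ᵥ*-cong M u≗u′ j = ∑-cong (λ i → cong (_* M i j) (u≗u′ i))

  0ᵥ* : ∀ {k c} (M : Mat k c) → (0v ᵥ* M) ≗ 0v
  0ᵥ* M j = ∑-0 (λ i → zeroˡ (M i j))

  lc-ᵥ* : ∀ {r k c} (a : Fin r → Carrier) (f : Fin r → Vec k) (M : Mat k c) → (lc a f ᵥ* M) ≗ lc a (λ i → f i ᵥ* M)
  lc-ᵥ* a f M j = begin
    ∑ (λ i → ∑ (λ l → a l * f l i) * M i j)        ≡⟨ ∑-cong (λ i → ∑-*ʳ (M i j) (λ l → a l * f l i)) ⟩
    ∑ (λ i → ∑ (λ l → (a l * f l i) * M i j))      ≡⟨ ∑-comm (λ i l → (a l * f l i) * M i j) ⟩
    ∑ (λ l → ∑ (λ i → (a l * f l i) * M i j))      ≡⟨ ∑-cong (λ l → trans (∑-cong (λ i → *-assoc (a l) (f l i) (M i j))) (sym (∑-*ˡ (a l) (λ i → f l i * M i j)))) ⟩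
    ∑ (λ l → a l * (f l ᵥ* M) j)                   ∎

  ᵥ*-· : ∀ {a b c} (u : Vec a) (A : Mat a b) (B : Mat b c) → ((u ᵥ* A) ᵥ* B) ≗ (u ᵥ* (A · B))
  ᵥ*-· u A B j = lc-ᵥ* u A B j

  ᵥ*-I : ∀ {k} (u : Vec k) → (u ᵥ* I) ≗ u
  ᵥ*-I u j = ∑-δʳ j u

  ᵥ*-inverse : ∀ {k} (M M′ : Mat k k) → (∀ i j → (M · M′) i j ≡ I i j) → ∀ u → ((u ᵥ* M) ᵥ* M′) ≗ u
  ᵥ*-inverse M M′ MM′≡I u j = trans (ᵥ*-· u M M′ j) (trans (∑-cong (λ i → cong (u i *_) (MM′≡I i j))) (ᵥ*-I u j))

  dot : ∀ {n} → Vec n → Vec n → Carrier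
  dot u v = ∑ (λ j → u j * v j)

  dot-cong : ∀ {n} {u u′ v v′ : Vec n} → u ≗ u′ → v ≗ v′ → dot u v ≡ dot u′ v′
  dot-cong u≗u′ v≗v′ = ∑-cong (λ j → cong₂ _*_ (u≗u′ j) (v≗v′ j))

  dot-congʳ : ∀ {n} {u v v′ : Vec n} → v ≗ v′ → dot u v ≡ dot u v′
  dot-congʳ = dot-cong (λ _ → refl)

  dot-comm : ∀ {n} (u v : Vec n) → dot u v ≡ dot v u
  dot-comm u v = ∑-cong (λ j → *-comm (u j) (v j))

  dot-remove : ∀ {n} (p : Fin (suc n)) (u v : Vec (suc n)) → dot u v ≡ u p * v p + dot (u ∘ punchIn p) (v ∘ punchIn p)
  dot-remove p u v = ∑-remove p (λ j → u j * v j)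

  dot-lc : ∀ {r n} (u : Vec n) (c : Fin r → Carrier) (e : Fin r → Vec n) → dot u (lc c e) ≡ ∑ (λ l → c l * dot u (e l))
  dot-lc u c e = begin
    ∑ (λ j → u j * ∑ (λ l → c l * e l j))        ≡⟨ ∑-cong (λ j → ∑-*ˡ (u j) (λ l → c l * e l j)) ⟩
    ∑ (λ j → ∑ (λ l → u j * (c l * e l j)))      ≡⟨ ∑-comm (λ j l → u j * (c l * e l j)) ⟩
    ∑ (λ l → ∑ (λ j → u j * (c l * e l j)))      ≡⟨ ∑-cong (λ l → ∑-cong (λ j → *-leftComm (u j) (c l) (e l j))) ⟩
    ∑ (λ l → ∑ (λ j → c l * (u j * e l j)))      ≡⟨ ∑-cong (λ l → sym (∑-*ˡ (c l) (λ j → u j * e l j))) ⟩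
    ∑ (λ l → c l * dot u (e l))                  ∎

-- Spans and independence with coefficients in a subfield S ↪ L; used for S = F (via ι) and for S = L.
module SubfieldSpans
  (E : FieldExtension) (S : Field)
  (φ : Field.Carrier S → Field.Carrier (FieldExtension.Top E))
  (φ-1 : φ (Field.1# S) ≡ Field.1# (FieldExtension.Top E))
  (φ-+ : ∀ x y → φ (Field._+_ S x y) ≡ Field._+_ (FieldExtension.Top E) (φ x) (φ y))
  (φ-* : ∀ x y → φ (Field._*_ S x y) ≡ Field._*_ (FieldExtension.Top E) (φ x) (φ y))
  (finL : Finiteness.Finite (Field.Carrier (FieldExtension.Top E)))
  (finS : Finiteness.Finite (Field.Carrier S))
  where

  open import Data.Empty using (⊥-elim)
  import Data.Fin as Fin
  open import Data.Fin using (Fin; zero; suc; punchIn; punchOut; _↑ˡ_; _↑ʳ_; splitAt)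
  open import Data.Fin.Properties using (any?; punchIn-punchOut)
  open import Data.List using (List; []; _∷_; length)
  open import Data.List.Membership.Propositional using (_∈_)
  open import Data.List.Relation.Unary.Any using (here; there)
  import Data.Nat as ℕ
  open import Data.Nat using (ℕ; zero; suc; _≤_; _<_; _<?_; z≤n; s≤s)
  open import Data.Nat.Properties using (m≤n⇒m≤1+n; <-irrefl; ≤-antisym; ≮⇒≥)
  open import Data.Product using (∃; _×_; _,_; proj₁; proj₂)
  open import Data.Sum using (_⊎_; inj₁; inj₂)
  open import Data.Vec.Functional using (insertAt; _++_) renaming (_∷_ to _∷ᶠ_; [] to []ᶠ)
  open import Data.Vec.Functional.Properties using (insertAt-lookup; insertAt-punchIn; lookup-++ˡ; lookup-++ʳ)
  open import Data.Vec.Functional.Relation.Unary.All.Properties using (++⁺)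
  open import Function using (_∘_; _$_; case_of_)
  open import Relation.Binary.PropositionalEquality
  open import Relation.Nullary using (¬_; ¬?; Dec; yes; no)
  open import Relation.Nullary.Decidable using (decidable-stable; _×-dec_)
  open import Relation.Unary using (Decidable)
  open ≡-Reasoning

  open FieldExtension E using (Top)
  open Ext E
  open Field Top
  open FieldProperties Top
  open LinearCombinations E
  module S  = Field S
  module SP = FieldProperties S
  open FieldProperties.Sum S using (sum)
  open Finiteness using (∃-function?; ≗?)
  open Finiteness.Finite finS using () renaming (_≟_ to _≟S_)

  φ-0 : φ S.0# ≡ 0#
  φ-0 = x+x≈x⇒x≈0 (φ S.0#) (trans (sym (φ-+ S.0# S.0#)) (cong φ (SP.+-identityʳ S.0#)))

  φ-neg : ∀ x → φ (S.- x) ≡ - φ x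
  φ-neg x = +-inverseʳ-unique (φ x) (φ (S.- x)) (trans (sym (φ-+ x (S.- x))) (trans (cong φ (SP.-‿inverseʳ x)) φ-0))

  φ-sum : ∀ {n} (f : Fin n → S.Carrier) → φ (sum f) ≡ ∑ (φ ∘ f)
  φ-sum {zero}  f = φ-0
  φ-sum {suc n} f = trans (φ-+ _ _) (cong (φ (f zero) +_) (φ-sum (f ∘ suc)))

  φ-δ : ∀ {n} (p i : Fin n) → φ (SP.δ p i) ≡ δ p i
  φ-δ p i with p Fin.≟ i
  ... | yes _ = φ-1
  ... | no  _ = φ-0

  φ≡0⇒≡0 : ∀ x → φ x ≡ 0# → x ≡ S.0#
  φ≡0⇒≡0 x φx≡0 with x ≟S S.0#
  ... | yes x≡0 = x≡0
  ... | no  x≢0 = ⊥-elim (1≢0 (begin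
    1#                          ≡⟨ sym φ-1 ⟩
    φ S.1#                      ≡⟨ cong φ (sym (SP.inverseʳ x x≢0)) ⟩
    φ (x S.* SP.inv x x≢0)      ≡⟨ φ-* _ _ ⟩
    φ x * φ (SP.inv x x≢0)      ≡⟨ cong (_* _) φx≡0 ⟩
    0# * φ (SP.inv x x≢0)       ≡⟨ zeroˡ _ ⟩
    0#                          ∎))

  Span : ∀ {r n} → (Fin r → Vec n) → Vec n → Set
  Span {r} b x = ∃ λ (a : Fin r → S.Carrier) → x ≗ lc (φ ∘ a) b

  Independent : ∀ {r n} → (Fin r → Vec n) → Set
  Independent {r} b = ∀ (a : Fin r → S.Carrier) → lc (φ ∘ a) b ≗ 0v → ∀ i → a i ≡ S.0#

  Span-resp : ∀ {r n} {b : Fin r → Vec n} {x y} → x ≗ y → Span b x → Span b y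
  Span-resp x≗y (a , x≡) = a , λ j → trans (sym (x≗y j)) (x≡ j)

  Span-resp-family : ∀ {r n} {b b′ : Fin r → Vec n} {x} → (∀ i → b i ≗ b′ i) → Span b x → Span b′ x
  Span-resp-family b≗b′ (a , x≡) = a , λ j → trans (x≡ j) (lc-congʳ (φ ∘ a) b≗b′ j)

  Independent-resp-family : ∀ {r n} {b b′ : Fin r → Vec n} → (∀ i → b i ≗ b′ i) → Independent b → Independent b′
  Independent-resp-family b≗b′ ind a lc≡0 = ind a (λ j → trans (lc-congʳ (φ ∘ a) b≗b′ j) (lc≡0 j))

  lc-φδ : ∀ {r n} (p : Fin r) (b : Fin r → Vec n) → lc (φ ∘ SP.δ p) b ≗ b p
  lc-φδ p b j = trans (lc-congˡ b (φ-δ p) j) (lc-δ p b j)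

  Span-member : ∀ {r n} (b : Fin r → Vec n) p → Span b (b p)
  Span-member b p = SP.δ p , λ j → sym (lc-φδ p b j)

  Independent⇒≢0 : ∀ {r n} {b : Fin r → Vec n} → Independent b → ∀ p → ¬ (b p ≗ 0v)
  Independent⇒≢0 {b = b} ind p b≡0 = SP.1≢0 (trans (sym (SP.δ-diag p)) (ind (SP.δ p) (λ j → trans (lc-φδ p b j) (b≡0 j)) p))

  Span-trans : ∀ {r s n} {y : Fin r → Vec n} {z : Fin s → Vec n} {x} →
               (∀ i → Span z (y i)) → Span y x → Span z x
  Span-trans {r} {s} {y = y} {z} y⊆z (a , x≡) = (λ l → sum (λ i → a i S.* coeff i l)) , λ j → begin
    _                                                 ≡⟨ x≡ j ⟩
    lc (φ ∘ a) y j                                    ≡⟨ lc-congʳ (φ ∘ a) (proj₂ ∘ y⊆z) j ⟩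
    lc (φ ∘ a) (λ i → lc (φ ∘ coeff i) z) j           ≡⟨ lc-lc (φ ∘ a) (λ i → φ ∘ coeff i) z j ⟩
    lc (λ l → ∑ (λ i → φ (a i) * φ (coeff i l))) z j  ≡⟨ lc-congˡ z (λ l → sym (trans (φ-sum (λ i → a i S.* coeff i l)) (∑-cong (λ i → φ-* (a i) (coeff i l))))) j ⟩
    lc (λ l → φ (sum (λ i → a i S.* coeff i l))) z j  ∎
    where
    coeff : Fin r → Fin s → S.Carrier
    coeff = proj₁ ∘ y⊆z

  φ-− : ∀ a t b → φ (a SP.- t S.* b) ≡ φ a - φ t * φ b
  φ-− a t b = trans (φ-+ a _) (cong (φ a +_) (trans (φ-neg _) (cong -_ (φ-* t b))))

  -- One step of the Steinitz exchange: u i is used to remove w zero from the other u's.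
  module Exchange {r s n} (w : Fin (suc s) → Vec n) (u : Fin (suc r) → Vec n)
                  (c : Fin (suc r) → Fin (suc s) → S.Carrier) (u≡ : ∀ i → u i ≗ lc (φ ∘ c i) w)
                  (i : Fin (suc r)) (cᵢ₀≢0 : c i zero ≢ S.0#) where

    t : Fin r → S.Carrier
    t j = c (punchIn i j) zero S.* SP.inv (c i zero) cᵢ₀≢0

    u′ : Fin r → Vec n
    u′ j q = u (punchIn i j) q - φ (t j) * u i q

    t*cᵢ₀ : ∀ j → φ (t j) * φ (c i zero) ≡ φ (c (punchIn i j) zero)
    t*cᵢ₀ j = trans (sym (φ-* (t j) (c i zero)))
                    (cong φ (trans (SP.*-assoc _ _ _) (trans (cong (_ S.*_) (SP.inverseˡ _ cᵢ₀≢0)) (SP.*-identityʳ _))))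

    u′⊆span : ∀ j → Span (w ∘ suc) (u′ j)
    u′⊆span j = (λ l → c (punchIn i j) (suc l) SP.- t j S.* c i (suc l)) , λ q → begin
      u (punchIn i j) q - φ (t j) * u i q
        ≡⟨ cong₂ (λ a b → a - φ (t j) * b) (u≡ (punchIn i j) q) (u≡ i q) ⟩
      lc (φ ∘ c (punchIn i j)) w q - φ (t j) * lc (φ ∘ c i) w q
        ≡⟨ cong (λ a → (a * w zero q + lc (φ ∘ c (punchIn i j) ∘ suc) (w ∘ suc) q) - φ (t j) * lc (φ ∘ c i) w q) (sym (t*cᵢ₀ j)) ⟩
      ((φ (t j) * φ (c i zero)) * w zero q + lc (φ ∘ c (punchIn i j) ∘ suc) (w ∘ suc) q)
        - φ (t j) * (φ (c i zero) * w zero q + lc (φ ∘ c i ∘ suc) (w ∘ suc) q)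
        ≡⟨ eliminate (φ (t j)) _ _ _ _ ⟩
      lc (φ ∘ c (punchIn i j) ∘ suc) (w ∘ suc) q - φ (t j) * lc (φ ∘ c i ∘ suc) (w ∘ suc) q
        ≡⟨ sym (lc-−* _ _ (φ (t j)) (w ∘ suc) q) ⟩
      lc (λ l → φ (c (punchIn i j) (suc l)) - φ (t j) * φ (c i (suc l))) (w ∘ suc) q
        ≡⟨ lc-congˡ (w ∘ suc) (λ l → sym (φ-− _ _ _)) q ⟩
      lc (λ l → φ (c (punchIn i j) (suc l) SP.- t j S.* c i (suc l))) (w ∘ suc) q ∎

    -- a relation among the u′ is a relation among the u, with coefficient − Σ a j t j at u i
    u′-independent : Independent u → Independent u′
    u′-independent ind a lc≡0 j = trans (sym (insertAt-punchIn a i v j)) (ind A lcA≡0 (punchIn i j))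
      where
      v : S.Carrier
      v = S.- sum (λ j → a j S.* t j)
      A : Fin (suc r) → S.Carrier
      A = insertAt a i v
      φv*uᵢ : ∀ q → φ v * u i q ≡ ∑ (λ j → φ (a j) * - (φ (t j) * u i q))
      φv*uᵢ q = begin
        φ v * u i q                                 ≡⟨ cong (_* u i q) (trans (φ-neg _) (cong -_ (φ-sum (λ j → a j S.* t j)))) ⟩
        - ∑ (λ j → φ (a j S.* t j)) * u i q         ≡⟨ sym (-‿distribˡ-* _ _) ⟩
        - (∑ (λ j → φ (a j S.* t j)) * u i q)       ≡⟨ cong -_ (∑-*ʳ (u i q) (λ j → φ (a j S.* t j))) ⟩
        - ∑ (λ j → φ (a j S.* t j) * u i q)         ≡⟨ ∑-neg (λ j → φ (a j S.* t j) * u i q) ⟩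
        ∑ (λ j → - (φ (a j S.* t j) * u i q))       ≡⟨ ∑-cong (λ j → trans (cong -_ (trans (cong (_* u i q) (φ-* (a j) (t j))) (*-assoc _ _ _)))
                                                                            (-‿distribʳ-* (φ (a j)) _)) ⟩
        ∑ (λ j → φ (a j) * - (φ (t j) * u i q))     ∎
      lcA≡0 : lc (φ ∘ A) u ≗ 0v
      lcA≡0 q = begin
        lc (φ ∘ A) u q
          ≡⟨ lc-remove i (φ ∘ A) u q ⟩
        φ (A i) * u i q + lc (φ ∘ A ∘ punchIn i) (u ∘ punchIn i) q
          ≡⟨ cong₂ (λ x y → φ x * u i q + y) (insertAt-lookup a i v) (lc-congˡ (u ∘ punchIn i) (cong φ ∘ insertAt-punchIn a i v) q) ⟩
        φ v * u i q + lc (φ ∘ a) (u ∘ punchIn i) q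
          ≡⟨ trans (+-comm _ _) (cong (lc (φ ∘ a) (u ∘ punchIn i) q +_) (φv*uᵢ q)) ⟩
        lc (φ ∘ a) (u ∘ punchIn i) q + ∑ (λ j → φ (a j) * - (φ (t j) * u i q))
          ≡⟨ sym (∑-+ (λ j → φ (a j) * u (punchIn i j) q) (λ j → φ (a j) * - (φ (t j) * u i q))) ⟩
        ∑ (λ j → φ (a j) * u (punchIn i j) q + φ (a j) * - (φ (t j) * u i q))
          ≡⟨ ∑-cong (λ j → sym (distribˡ (φ (a j)) _ _)) ⟩
        lc (φ ∘ a) u′ q
          ≡⟨ lc≡0 q ⟩
        0#                                                                    ∎

  steinitz : ∀ s {r n} (w : Fin s → Vec n) (u : Fin r → Vec n) → Independent u → (∀ i → Span w (u i)) → r ≤ s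
  steinitz _       {zero}  _ _ _   _   = z≤n
  steinitz zero    {suc r} w u ind u⊆w = ⊥-elim (Independent⇒≢0 {b = u} ind zero (proj₂ (u⊆w zero)))
  steinitz (suc s) {suc r} w u ind u⊆w with any? (λ i → ¬? (c i zero ≟S S.0#))
    where c = proj₁ ∘ u⊆w
  ... | yes (i , cᵢ₀≢0) = s≤s (steinitz s (w ∘ suc) u′ (u′-independent ind) u′⊆span)
    where open Exchange w u (proj₁ ∘ u⊆w) (proj₂ ∘ u⊆w) i cᵢ₀≢0
  ... | no ∄i = m≤n⇒m≤1+n (steinitz s (w ∘ suc) u ind λ i →
                   proj₁ (u⊆w i) ∘ suc , λ q → trans (proj₂ (u⊆w i) q) (lc-tail (φ ∘ proj₁ (u⊆w i)) w (trans (cong φ (cᵢ₀≡0 i)) φ-0) q))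
    where
    cᵢ₀≡0 : ∀ i → proj₁ (u⊆w i) zero ≡ S.0#
    cᵢ₀≡0 i = decidable-stable (proj₁ (u⊆w i) zero ≟S S.0#) (λ cᵢ₀≢0 → ∄i (i , cᵢ₀≢0))

  Span-solve : ∀ {r n} {c₀ : S.Carrier} (c₀≢0 : c₀ ≢ S.0#) (c : Fin r → S.Carrier) {x : Vec n} (f : Fin r → Vec n) →
               (∀ q → φ c₀ * x q + lc (φ ∘ c) f q ≡ 0#) → Span f x
  Span-solve {c₀ = c₀} c₀≢0 c {x} f rel = (λ j → S.- (c₀⁻¹ S.* c j)) , λ q → begin
    x q                                    ≡⟨ sym (*-identityˡ _) ⟩
    1# * x q                               ≡⟨ cong (_* x q) (sym (trans (sym (φ-* c₀⁻¹ c₀)) (trans (cong φ (SP.inverseˡ c₀ c₀≢0)) φ-1))) ⟩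
    (φ c₀⁻¹ * φ c₀) * x q                  ≡⟨ *-assoc _ _ _ ⟩
    φ c₀⁻¹ * (φ c₀ * x q)                  ≡⟨ cong (φ c₀⁻¹ *_) (+-inverseˡ-unique _ _ (rel q)) ⟩
    φ c₀⁻¹ * - lc (φ ∘ c) f q              ≡⟨ sym (-‿distribʳ-* _ _) ⟩
    - (φ c₀⁻¹ * lc (φ ∘ c) f q)            ≡⟨ cong -_ (sym (lc-* (φ c₀⁻¹) (φ ∘ c) f q)) ⟩
    - lc (λ j → φ c₀⁻¹ * φ (c j)) f q      ≡⟨ sym (lc-neg (λ j → φ c₀⁻¹ * φ (c j)) f q) ⟩
    lc (λ j → - (φ c₀⁻¹ * φ (c j))) f q    ≡⟨ lc-congˡ f (λ j → sym (trans (φ-neg _) (cong -_ (φ-* _ _)))) q ⟩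
    lc (λ j → φ (S.- (c₀⁻¹ S.* c j))) f q  ∎
    where c₀⁻¹ = SP.inv c₀ c₀≢0

  independent-in-span⇒independent : ∀ {k n} (g b : Fin k → Vec n) → Independent b → (∀ i → Span g (b i)) → Independent g
  independent-in-span⇒independent {suc k} g b ind-b b⊆g a rel p with a p ≟S S.0#
  ... | yes aₚ≡0 = aₚ≡0
  ... | no  aₚ≢0 = ⊥-elim (<-irrefl refl (steinitz k (g ∘ punchIn p) b ind-b (λ i → Span-trans g⊆ (b⊆g i))))
    where
    gₚ∈ : Span (g ∘ punchIn p) (g p)
    gₚ∈ = Span-solve aₚ≢0 (a ∘ punchIn p) (g ∘ punchIn p) (λ q → trans (sym (lc-remove p (φ ∘ a) g q)) (rel q))
    g⊆ : ∀ l → Span (g ∘ punchIn p) (g l)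
    g⊆ l with p Fin.≟ l
    ... | yes refl = gₚ∈
    ... | no  p≢l  = subst (Span (g ∘ punchIn p) ∘ g) (punchIn-punchOut p≢l) (Span-member (g ∘ punchIn p) (punchOut p≢l))

  Span? : ∀ {r n} (b : Fin r → Vec n) x → Dec (Span b x)
  Span? b x = ∃-function? finS (λ a≗a′ x≡ j → trans (x≡ j) (lc-congˡ b (cong φ ∘ a≗a′) j)) (λ a → ≗? finL x (lc (φ ∘ a) b))

  Independent-∷ : ∀ {r n} {f : Fin r → Vec n} {x} → Independent f → ¬ Span f x → Independent (x ∷ᶠ f)
  Independent-∷ {f = f} {x} ind x∉ C rel i with C zero ≟S S.0#
  ... | no  C₀≢0 = ⊥-elim (x∉ (Span-solve C₀≢0 (C ∘ suc) f rel))
  ... | yes C₀≡0 = Cᵢ≡0 i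
    where
    Cᵢ≡0 : ∀ i → C i ≡ S.0#
    Cᵢ≡0 zero    = C₀≡0
    Cᵢ≡0 (suc i) = ind (C ∘ suc) (λ q → trans (sym (lc-tail (φ ∘ C) (x ∷ᶠ f) (trans (cong φ C₀≡0) φ-0) q)) (rel q)) i

  Span-∷ : ∀ {r n} {f : Fin r → Vec n} {x y} → Span f y → Span (x ∷ᶠ f) y
  Span-∷ {f = f} {x} (a , y≡) = (S.0# ∷ᶠ a) , λ q → trans (y≡ q) (sym (lc-tail (φ ∘ (S.0# ∷ᶠ a)) (x ∷ᶠ f) φ-0 q))

  lc-++ : ∀ {a b n} (c : Fin (a ℕ.+ b) → Carrier) (f : Fin a → Vec n) (g : Fin b → Vec n) q →
          lc c (f ++ g) q ≡ lc (λ i → c (i ↑ˡ b)) f q + lc (λ j → c (a ↑ʳ j)) g q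
  lc-++ {a} {b} c f g q = trans (lc-↑ {a} {b} c (f ++ g) q)
    (cong₂ _+_ (lc-congʳ (λ i → c (i ↑ˡ b)) (λ i q → cong (λ v → v q) (lookup-++ˡ f g i)) q)
               (lc-congʳ (λ j → c (a ↑ʳ j)) (λ j q → cong (λ v → v q) (lookup-++ʳ f g j)) q))

  Span-++⁺ˡ : ∀ {a b n} (f : Fin a → Vec n) (g : Fin b → Vec n) {y} → Span f y → Span (f ++ g) y
  Span-++⁺ˡ {b = b} f g = Span-trans λ i → subst (Span (f ++ g)) (lookup-++ˡ f g i) (Span-member (f ++ g) (i ↑ˡ b))

  Span-++⁺ʳ : ∀ {a b n} (f : Fin a → Vec n) (g : Fin b → Vec n) {y} → Span g y → Span (f ++ g) y
  Span-++⁺ʳ {a} f g = Span-trans λ j → subst (Span (f ++ g)) (lookup-++ʳ f g j) (Span-member (f ++ g) (a ↑ʳ j))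

  Span-++[] : ∀ {a n} (f : Fin a → Vec n) {y} → Span (f ++ []ᶠ) y → Span f y
  Span-++[] f = Span-trans (++⁺ (Span f) (Span-member f) (λ ()))

  Independent-++⁻ˡ : ∀ {a b n} (f : Fin a → Vec n) (g : Fin b → Vec n) → Independent (f ++ g) → Independent f
  Independent-++⁻ˡ {a} {b} f g ind c rel i = trans (sym (lookup-++ˡ c C₀ i)) (ind (c ++ C₀) rel′ (i ↑ˡ b))
    where
    C₀ : Fin b → S.Carrier
    C₀ _ = S.0#
    rel′ : lc (φ ∘ (c ++ C₀)) (f ++ g) ≗ 0v
    rel′ q = begin
      lc (φ ∘ (c ++ C₀)) (f ++ g) q                                            ≡⟨ lc-++ (φ ∘ (c ++ C₀)) f g q ⟩
      lc (λ i → φ ((c ++ C₀) (i ↑ˡ b))) f q + lc (λ j → φ ((c ++ C₀) (a ↑ʳ j))) g q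
        ≡⟨ cong₂ _+_ (lc-congˡ f (λ i → cong φ (lookup-++ˡ c C₀ i)) q) (lc-zeroˡ g (λ j → trans (cong φ (lookup-++ʳ c C₀ j)) φ-0) q) ⟩
      lc (φ ∘ c) f q + 0#                                                      ≡⟨ trans (+-identityʳ _) (rel q) ⟩
      0#                                                                       ∎

  record Extension {n a} (acc : Fin a → Vec n) (P : Vec n → Set) (b : ℕ) (xs : List (Vec n)) : Set where
    field
      size        : ℕ
      new         : Fin size → Vec n
      size≤bound  : size ≤ b
      size≤length : size ≤ length xs
      new∈P       : ∀ i → P (new i)
      independent : Independent (new ++ acc)
      saturated   : size ≡ b ⊎ (∀ x → x ∈ xs → P x → Span (new ++ acc) x)

  extend : ∀ {n a} (acc : Fin a → Vec n) → Independent acc → (P : Vec n → Set) → Decidable P →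
           (b : ℕ) (xs : List (Vec n)) → Extension acc P b xs
  extend acc ind P P? b [] = record
    { size = 0 ; new = λ () ; size≤bound = z≤n ; size≤length = z≤n ; new∈P = λ ()
    ; independent = ind ; saturated = inj₂ λ _ () }
  extend {n} acc ind P P? b (x ∷ xs) = step (extend acc ind P P? b xs)
    where
    open Extension
    skip : (e : Extension acc P b xs) → size e ≡ b ⊎ (∀ y → y ∈ x ∷ xs → P y → Span (new e ++ acc) y) →
           Extension acc P b (x ∷ xs)
    skip e sat = record
      { size = size e ; new = new e ; size≤bound = size≤bound e ; size≤length = m≤n⇒m≤1+n (size≤length e)
      ; new∈P = new∈P e ; independent = independent e ; saturated = sat }
    ∷-++ : ∀ {s} (f : Fin s → Vec n) → ((x ∷ᶠ f) ++ acc) ≗ (x ∷ᶠ (f ++ acc))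
    ∷-++ {s} f zero    = refl
    ∷-++ {s} f (suc i) with splitAt s i
    ... | inj₁ _ = refl
    ... | inj₂ _ = refl
    add : (e : Extension acc P b xs) → P x → ¬ Span (new e ++ acc) x → size e < b →
          (∀ y → y ∈ xs → P y → Span (new e ++ acc) y) → Extension acc P b (x ∷ xs)
    add e Px x∉ size<b sat = record
      { size = suc (size e) ; new = x ∷ᶠ new e ; size≤bound = size<b ; size≤length = s≤s (size≤length e)
      ; new∈P = λ { zero → Px ; (suc i) → new∈P e i }
      ; independent = Independent-resp-family (λ i q → sym (cong (_$ q) (∷-++ (new e) i))) (Independent-∷ (independent e) x∉)
      ; saturated = inj₂ λ y y∈ Py → Span-resp-family (λ i q → sym (cong (_$ q) (∷-++ (new e) i))) (case y∈ of λ
          { (here refl) → Span-member (x ∷ᶠ (new e ++ acc)) zero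
          ; (there y∈xs) → Span-∷ (sat y y∈xs Py) }) }
    step : Extension acc P b xs → Extension acc P b (x ∷ xs)
    step e with saturated e | P? x | Span? (new e ++ acc) x | size e <? b
    ... | inj₁ full | _      | _     | _       = skip e (inj₁ full)
    ... | inj₂ sat  | no ¬Px | _     | _       = skip e (inj₂ λ { y (here refl) Py → ⊥-elim (¬Px Py) ; y (there y∈) → sat y y∈ })
    ... | inj₂ sat  | yes _  | yes x∈ | _      = skip e (inj₂ λ { y (here refl) _ → x∈ ; y (there y∈) → sat y y∈ })
    ... | inj₂ sat  | yes Px | no x∉ | yes s<b = add e Px x∉ s<b sat
    ... | inj₂ _    | yes _  | no _  | no s≮b  = skip e (inj₁ (≤-antisym (size≤bound e) (≮⇒≥ s≮b)))

  change-of-basis : ∀ {r m n} (b : Fin r → Vec n) (y : Fin m → Vec n) → Independent b →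
                    (A : Fin m → Fin r → S.Carrier) → (∀ j → y j ≗ lc (φ ∘ A j) b) →
                    (e : Fin r → Fin m → S.Carrier) → (∀ l → b l ≗ lc (φ ∘ e l) y) →
                    ∀ l i → sum (λ j → e l j S.* A j i) ≡ SP.δ l i
  change-of-basis b y b-ind A y≡ e b≡ l i = SP.x∙y⁻¹≈ε⇒x≈y (τ i) (SP.δ l i) (b-ind (λ i → τ i SP.- SP.δ l i) rel i)
    where
    τ : Fin _ → S.Carrier
    τ i = sum (λ j → e l j S.* A j i)
    rel : lc (λ i → φ (τ i SP.- SP.δ l i)) b ≗ 0v
    rel q = begin
      lc (λ i → φ (τ i SP.- SP.δ l i)) b q                 ≡⟨ lc-congˡ b (λ i → trans (φ-+ (τ i) (S.- SP.δ l i)) (cong (φ (τ i) +_) (φ-neg (SP.δ l i)))) q ⟩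
      lc (λ i → φ (τ i) - φ (SP.δ l i)) b q                ≡⟨ lc-+ (φ ∘ τ) (λ i → - φ (SP.δ l i)) b q ⟩
      lc (φ ∘ τ) b q + lc (λ i → - φ (SP.δ l i)) b q       ≡⟨ cong₂ _+_ τb≡ (trans (lc-neg (φ ∘ SP.δ l) b q) (cong -_ (lc-φδ l b q))) ⟩
      b l q - b l q                                        ≡⟨ -‿inverseʳ (b l q) ⟩
      0#                                                   ∎
      where
      τb≡ : lc (φ ∘ τ) b q ≡ b l q
      τb≡ = begin
        lc (φ ∘ τ) b q                                     ≡⟨ lc-congˡ b (λ i → trans (φ-sum (λ j → e l j S.* A j i)) (∑-cong (λ j → φ-* (e l j) (A j i)))) q ⟩
        lc (λ i → ∑ (λ j → φ (e l j) * φ (A j i))) b q     ≡⟨ sym (lc-lc (φ ∘ e l) (λ j → φ ∘ A j) b q) ⟩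
        lc (φ ∘ e l) (λ j → lc (φ ∘ A j) b) q              ≡⟨ sym (lc-congʳ (φ ∘ e l) y≡ q) ⟩
        lc (φ ∘ e l) y q                                   ≡⟨ sym (b≡ l q) ⟩
        b l q                                              ∎

  independent-or-relation : ∀ {r n} (b : Fin r → Vec n) →
                            Independent b ⊎ ∃ λ a → lc (φ ∘ a) b ≗ 0v × ∃ λ i → a i ≢ S.0#
  independent-or-relation b with ∃-function? finS {P = λ a → lc (φ ∘ a) b ≗ 0v × ∃ λ i → a i ≢ S.0#}
      (λ a≗a′ (rel , i , aᵢ≢0) → (λ q → trans (sym (lc-congˡ b (cong φ ∘ a≗a′) q)) (rel q)) , i , λ a′ᵢ≡0 → aᵢ≢0 (trans (a≗a′ i) a′ᵢ≡0))
      (λ a → ≗? finL (lc (φ ∘ a) b) 0v ×-dec any? (λ i → ¬? (a i ≟S S.0#)))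
  ... | yes relation = inj₂ relation
  ... | no ∄relation = inj₁ λ a rel i → decidable-stable (a i ≟S S.0#) λ aᵢ≢0 → ∄relation (a , rel , i , aᵢ≢0)

  record BasisOf {n} (P : Vec n → Set) (xs : List (Vec n)) : Set where
    field
      size        : ℕ
      basis       : Fin size → Vec n
      basis∈P     : ∀ i → P (basis i)
      independent : Independent basis
      size≤length : size ≤ length xs
      spans       : ∀ x → x ∈ xs → P x → Span basis x

  basisOf : ∀ {n} (P : Vec n → Set) → Decidable P → (xs : List (Vec n)) → BasisOf P xs
  basisOf P P? xs = record
    { size = size ; basis = new ; basis∈P = new∈P ; size≤length = size≤length
    ; independent = Independent-++⁻ˡ new []ᶠ independent
    ; spans = λ x x∈ Px → Span-++[] new (spans x x∈ Px) }
    where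
    open Extension (extend []ᶠ (λ _ _ ()) P P? (suc (length xs)) xs)
    spans : ∀ x → x ∈ xs → P x → Span (new ++ []ᶠ) x
    spans with saturated
    ... | inj₁ size≡ = ⊥-elim (<-irrefl size≡ (s≤s size≤length))
    ... | inj₂ sat   = sat

module Kernels (E : FieldExtension) (finL : Finiteness.Finite (Field.Carrier (FieldExtension.Top E))) where

  open import Data.Empty using (⊥-elim)
  import Data.Fin as Fin
  open import Data.Fin using (Fin; zero; suc; punchIn; punchOut)
  open import Data.Fin.Properties using (any?; punchIn-punchOut)
  import Data.Nat as ℕ
  open import Data.Nat using (ℕ; zero; suc)
  open import Data.Product using (∃; _×_; _,_)
  open import Data.Vec.Functional using (insertAt) renaming (_∷_ to _∷ᶠ_)
  open import Data.Vec.Functional.Properties using (insertAt-lookup; insertAt-punchIn)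
  open import Function using (_∘_)
  open import Relation.Binary.PropositionalEquality
  open import Relation.Nullary using (¬_; ¬?; yes; no)
  open import Relation.Nullary.Decidable using (decidable-stable)
  open ≡-Reasoning

  open FieldExtension E using (Top)
  open Ext E
  open Field Top
  open FieldProperties Top
  open LinearCombinations E
  open SubfieldSpans E Top (λ x → x) refl (λ _ _ → refl) (λ _ _ → refl) finL finL
  open Finiteness.Finite finL using (_≟_)

  InKernel : ∀ {k n} → (Fin k → Vec n) → Vec n → Set
  InKernel r v = ∀ i → dot (r i) v ≡ 0#

  KernelBasis : ∀ {k n} → (Fin k → Vec n) → Set
  KernelBasis {k} {n} r = ∃ λ t → k ℕ.+ t ≡ n × ∃ λ (e : Fin t → Vec n) →
    (∀ l → InKernel r (e l)) × Independent e × (∀ v → InKernel r v → Span e v)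

  nonzero-entry : ∀ {n} (v : Vec n) → ¬ (v ≗ 0v) → ∃ λ p → v p ≢ 0#
  nonzero-entry v v≢0 with any? (λ p → ¬? (v p ≟ 0#))
  ... | yes p = p
  ... | no ∄p = ⊥-elim (v≢0 λ p → decidable-stable (v p ≟ 0#) (λ vₚ≢0 → ∄p (p , vₚ≢0)))

  -- Gaussian elimination on the pivot r zero p ≠ 0: solving the first equation for the
  -- p-th coordinate identifies the kernel of r with that of k reduced rows in one variable less.
  module Pivot {k n} (r : Fin (suc k) → Vec (suc n)) (p : Fin (suc n)) (π≢0 : r zero p ≢ 0#) where

    π : Carrier
    π = r zero p

    ρ : Carrier
    ρ = inv π π≢0

    solve : Vec n → Carrier
    solve w = - (ρ * dot (r zero ∘ punchIn p) w)

    lift : Vec n → Vec (suc n)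
    lift w = insertAt w p (solve w)

    T : Fin k → Carrier
    T i = r (suc i) p * ρ

    reduced : Fin k → Vec n
    reduced i j = r (suc i) (punchIn p j) - T i * r zero (punchIn p j)

    lift-punchIn : ∀ w j → lift w (punchIn p j) ≡ w j
    lift-punchIn w = insertAt-punchIn w p (solve w)

    lift-cong : ∀ {w w′} → w ≗ w′ → lift w ≗ lift w′
    lift-cong {w} {w′} w≗w′ q with p Fin.≟ q
    ... | yes refl = trans (insertAt-lookup w p _) (trans (cong (λ z → - (ρ * z)) (dot-congʳ w≗w′)) (sym (insertAt-lookup w′ p _)))
    ... | no p≢q rewrite sym (punchIn-punchOut p≢q) = trans (lift-punchIn w _) (trans (w≗w′ _) (sym (lift-punchIn w′ _)))

    lift-pivot : ∀ w → lift w p ≡ solve w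
    lift-pivot w = insertAt-lookup w p (solve w)

    D : Vec n → Carrier
    D w = dot (r zero ∘ punchIn p) w

    dot-lift : ∀ (u : Vec (suc n)) w → dot u (lift w) ≡ u p * solve w + dot (u ∘ punchIn p) w
    dot-lift u w = trans (dot-remove p u (lift w)) (cong₂ (λ a b → u p * a + b) (lift-pivot w) (dot-congʳ (lift-punchIn w)))

    lift∈kernel₀ : ∀ w → dot (r zero) (lift w) ≡ 0#
    lift∈kernel₀ w = begin
      dot (r zero) (lift w)           ≡⟨ dot-lift (r zero) w ⟩
      π * - (ρ * D w) + D w           ≡⟨ cong (_+ D w) (trans (sym (-‿distribʳ-* π _)) (cong -_ (*-cancel-inv π π≢0 (D w)))) ⟩
      - D w + D w                     ≡⟨ -‿inverseˡ (D w) ⟩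
      0#                              ∎

    dot-lift-reduced : ∀ i w → dot (r (suc i)) (lift w) ≡ dot (reduced i) w
    dot-lift-reduced i w = begin
      dot (r (suc i)) (lift w)                                ≡⟨ dot-lift (r (suc i)) w ⟩
      r (suc i) p * - (ρ * D w) + dot (r (suc i) ∘ punchIn p) w
        ≡⟨ trans (+-comm _ _) (cong (dot (r (suc i) ∘ punchIn p) w +_) (trans (sym (-‿distribʳ-* _ _)) (cong -_ (sym (*-assoc _ ρ (D w)))))) ⟩
      dot (r (suc i) ∘ punchIn p) w - T i * D w               ≡⟨ sym (lc-−* (r (suc i) ∘ punchIn p) (r zero ∘ punchIn p) (T i) (λ j (_ : Fin 1) → w j) zero) ⟩
      dot (reduced i) w                                       ∎

    lift-restrict : ∀ v → dot (r zero) v ≡ 0# → v ≗ lift (v ∘ punchIn p)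
    lift-restrict v v∈ q with p Fin.≟ q
    ... | yes refl = begin
      v p                          ≡⟨ sym (inv-cancel-* π π≢0 (v p)) ⟩
      ρ * (π * v p)                ≡⟨ cong (ρ *_) (+-inverseˡ-unique _ _ (trans (sym (dot-remove p (r zero) v)) v∈)) ⟩
      ρ * - D (v ∘ punchIn p)      ≡⟨ sym (-‿distribʳ-* ρ _) ⟩
      solve (v ∘ punchIn p)        ≡⟨ sym (lift-pivot (v ∘ punchIn p)) ⟩
      lift (v ∘ punchIn p) p       ∎
    ... | no p≢q rewrite sym (punchIn-punchOut p≢q) = sym (lift-punchIn (v ∘ punchIn p) _)

    reduced-independent : Independent r → Independent reduced
    reduced-independent ind c rel i = ind ((- K) ∷ᶠ c) rel′ (suc i)
      where
      K : Carrier
      K = ∑ (λ i → c i * T i)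
      X : Vec (suc n)
      X = lc c (r ∘ suc)
      Kπ≡X : K * π ≡ X p
      Kπ≡X = trans (∑-*ʳ π (λ i → c i * T i)) (∑-cong (λ i → trans (*-assoc (c i) (T i) π)
               (cong (c i *_) (trans (*-assoc _ ρ π) (trans (cong (r (suc i) p *_) (inverseˡ π π≢0)) (*-identityʳ _))))))
      rel′ : lc ((- K) ∷ᶠ c) r ≗ 0v
      rel′ q with p Fin.≟ q
      ... | yes refl = trans (cong (_+ X p) (trans (sym (-‿distribˡ-* K π)) (cong -_ Kπ≡X))) (-‿inverseˡ (X p))
      ... | no p≢q rewrite sym (punchIn-punchOut p≢q) = begin
        - K * r zero (punchIn p j) + X (punchIn p j)                ≡⟨ +-comm _ _ ⟩
        X (punchIn p j) + - K * r zero (punchIn p j)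
          ≡⟨ cong (X (punchIn p j) +_) (trans (sym (-‿distribˡ-* K _)) (cong -_ (∑-*ʳ (r zero (punchIn p j)) (λ i → c i * T i)))) ⟩
        X (punchIn p j) + - ∑ (λ i → (c i * T i) * r zero (punchIn p j))
          ≡⟨ cong (X (punchIn p j) +_) (trans (∑-neg (λ i → (c i * T i) * r zero (punchIn p j))) (∑-cong (λ i → trans (cong -_ (*-assoc (c i) (T i) _)) (-‿distribʳ-* (c i) _)))) ⟩
        X (punchIn p j) + ∑ (λ i → c i * - (T i * r zero (punchIn p j)))
          ≡⟨ sym (∑-+ (λ i → c i * r (suc i) (punchIn p j)) (λ i → c i * - (T i * r zero (punchIn p j)))) ⟩
        ∑ (λ i → c i * r (suc i) (punchIn p j) + c i * - (T i * r zero (punchIn p j)))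
          ≡⟨ ∑-cong (λ i → sym (distribˡ (c i) _ _)) ⟩
        lc c reduced j                                              ≡⟨ rel j ⟩
        0#                                                          ∎
        where j = punchOut p≢q

    lift-kernelBasis : KernelBasis reduced → KernelBasis r
    lift-kernelBasis (t , k+t≡n , e , e∈ , ind , span) = t , cong suc k+t≡n , lift ∘ e , lift-e∈ , lift-ind , lift-span
      where
      lc-restrict : ∀ (c : Fin t → Carrier) j → lc c (lift ∘ e) (punchIn p j) ≡ lc c e j
      lc-restrict c j = ∑-cong (λ l → cong (c l *_) (lift-punchIn (e l) j))
      lift-e∈ : ∀ l → InKernel r (lift (e l))
      lift-e∈ l zero    = lift∈kernel₀ (e l)
      lift-e∈ l (suc i) = trans (dot-lift-reduced i (e l)) (e∈ l i)
      lift-ind : Independent (lift ∘ e)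
      lift-ind c rel = ind c (λ j → trans (sym (lc-restrict c j)) (rel (punchIn p j)))
      lift-span : ∀ v → InKernel r v → Span (lift ∘ e) v
      lift-span v v∈ with span (v ∘ punchIn p) (λ i → trans (sym (dot-lift-reduced i _)) (trans (dot-congʳ {u = r (suc i)} (sym ∘ lift-restrict v (v∈ zero))) (v∈ (suc i))))
      ... | c , v≡ = c , λ q → begin
        v q                             ≡⟨ lift-restrict v (v∈ zero) q ⟩
        lift (v ∘ punchIn p) q          ≡⟨ lift-cong (λ j → trans (v≡ j) (sym (lc-restrict c j))) q ⟩
        lift (lc c (lift ∘ e) ∘ punchIn p) q ≡⟨ sym (lift-restrict (lc c (lift ∘ e)) lc∈ q) ⟩
        lc c (lift ∘ e) q               ∎
        where
        lc∈ : dot (r zero) (lc c (lift ∘ e)) ≡ 0#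
        lc∈ = trans (dot-lc (r zero) c (lift ∘ e)) (∑-0 (λ l → trans (cong (c l *_) (lift-e∈ l zero)) (zeroʳ (c l))))

  kernelBasis : ∀ k {n} (r : Fin k → Vec n) → Independent r → KernelBasis r
  kernelBasis zero    {n}     r _   = n , refl , I , (λ _ ()) , (λ a rel i → trans (sym (∑-δʳ i a)) (rel i)) , (λ v _ → v , λ j → sym (∑-δʳ j v))
  kernelBasis (suc k) {zero}  r ind = ⊥-elim (Independent⇒≢0 {b = r} ind zero (λ ()))
  kernelBasis (suc k) {suc n} r ind with nonzero-entry (r zero) (Independent⇒≢0 {b = r} ind zero)
  ... | p , π≢0 = lift-kernelBasis (kernelBasis k reduced (reduced-independent ind))
    where open Pivot r p π≢0

module Subfield (E : FieldExtension)
  (finF : Finiteness.Finite (Field.Carrier (FieldExtension.Base E)))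
  (finL : Finiteness.Finite (Field.Carrier (FieldExtension.Top E))) where

  open import Data.Fin using (Fin; zero; suc)
  open import Data.List using (map; allFin)
  open import Data.List.Membership.Propositional.Properties using (∈-map⁺; ∈-allFin)
  open import Data.Nat using (zero; suc; _≤_)
  open import Data.Product using (∃; _×_; _,_; proj₁; proj₂)
  open import Data.Unit using (⊤; tt)
  open import Function using (_∘_)
  open import Relation.Binary.PropositionalEquality
  open import Relation.Nullary using (yes)
  open ≡-Reasoning

  open FieldExtension E
  open Ext E
  open Field Top
  open FieldProperties Top
  open LinearCombinations E
  module KS = SubfieldSpans E Base ι ι-1 ι-+ ι-* finL finF
  module LS = SubfieldSpans E Top (λ x → x) refl (λ _ _ → refl) (λ _ _ → refl) finL finL
  open Finiteness.Finite finL using (elements; complete)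
  open FieldProperties.Sum Base using (sum)

  module FBasisOfL = KS.BasisOf (KS.basisOf (λ _ → ⊤) (λ _ → yes tt) (map (λ y (_ : Fin 1) → y) elements))
    renaming (size to μ; basis to β; independent to β-independent)

  β-spans : ∀ y → KS.Span FBasisOfL.β (λ _ → y)
  β-spans y = FBasisOfL.spans (λ _ → y) (∈-map⁺ (λ y _ → y) (complete y)) tt

  -- Expanding the L-coefficients of a relation in an F-basis β of L splits it into F-relations.
  independent⇒L-independent : ∀ {r n} (a : Fin r → Fin n → F.Carrier) →
                              KS.Independent (λ i j → ι (a i j)) → LS.Independent (λ i j → ι (a i j))
  independent⇒L-independent {r} {n} a ind c rel i = begin
    c i                           ≡⟨ proj₂ (β-spans (c i)) zero ⟩
    lc (ι ∘ γ i) β zero           ≡⟨ lc-zeroˡ β (λ l → trans (cong ι (γ≡0 l i)) KS.φ-0) zero ⟩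
    0#                            ∎
    where
    open FBasisOfL using (μ; β; β-independent)
    γ : Fin r → Fin μ → F.Carrier
    γ i = proj₁ (β-spans (c i))
    σ : Fin μ → Fin n → F.Carrier
    σ l j = sum (λ i → γ i l F.* a i j)
    ισ : ∀ l j → ι (σ l j) ≡ ∑ (λ i → ι (a i j) * ι (γ i l))
    ισ l j = trans (KS.φ-sum (λ i → γ i l F.* a i j)) (∑-cong (λ i → trans (ι-* (γ i l) (a i j)) (*-comm (ι (γ i l)) (ι (a i j)))))
    σ≡0 : ∀ j l → σ l j ≡ F.0#
    σ≡0 j = β-independent (λ l → σ l j) λ q → begin
      lc (λ l → ι (σ l j)) β q                             ≡⟨ lc-congˡ β (λ l → ισ l j) q ⟩
      lc (λ l → ∑ (λ i → ι (a i j) * ι (γ i l))) β q       ≡⟨ sym (lc-lc (λ i → ι (a i j)) (λ i l → ι (γ i l)) β q) ⟩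
      ∑ (λ i → ι (a i j) * lc (ι ∘ γ i) β q)               ≡⟨ ∑-cong (λ i → trans (cong (ι (a i j) *_) (sym (proj₂ (β-spans (c i)) q))) (*-comm _ _)) ⟩
      lc c (λ i j → ι (a i j)) j                           ≡⟨ rel j ⟩
      0#                                                   ∎
    γ≡0 : ∀ l i → γ i l ≡ F.0#
    γ≡0 l = ind (λ i → γ i l) λ j → begin
      lc (λ i → ι (γ i l)) (λ i j → ι (a i j)) j           ≡⟨ ∑-cong (λ i → *-comm (ι (γ i l)) (ι (a i j))) ⟩
      ∑ (λ i → ι (a i j) * ι (γ i l))                      ≡⟨ sym (ισ l j) ⟩
      ι (σ l j)                                            ≡⟨ cong ι (σ≡0 j l) ⟩
      ι F.0#                                               ≡⟨ KS.φ-0 ⟩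
      0#                                                   ∎

  entries : ∀ {n} → Vec n → Fin n → Vec 1
  entries v j _ = v j

  rankWeight≤ : ∀ {s n} (v : Vec n) (c : Fin s → Vec 1) → (∀ j → KSpan c (entries v j)) → ∃ λ e → RankWeight v e × e ≤ s
  rankWeight≤ {s} {n} v c entries⊆c = size , (basis , basis∈P , independent , λ x x∈ → KS.Span-trans span x∈) , size≤s
    where
    open KS.BasisOf (KS.basisOf (KSpan (entries v)) (KS.Span? (entries v)) (map (entries v) (allFin n)))
    span : ∀ j → KS.Span basis (entries v j)
    span j = spans (entries v j) (∈-map⁺ (entries v) (∈-allFin j)) (KS.Span-member (entries v) j)
    size≤s : size ≤ s
    size≤s = KS.steinitz s c basis independent (λ i → KS.Span-trans entries⊆c (basis∈P i))

module System (E : FieldExtension)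
  (finF : Finiteness.Finite (Field.Carrier (FieldExtension.Base E)))
  (finL : Finiteness.Finite (Field.Carrier (FieldExtension.Top E)))
  {k n} (G : Ext.Mat E k n) (G-rows : Ext.LIndep E G) (G-columns : Ext.KIndep E (Ext.columns E G))
  (M M′ : Ext.Mat E k k)
  (MM′≡I : ∀ i j → Ext._·_ E M M′ i j ≡ Ext.I E i j) (M′M≡I : ∀ i j → Ext._·_ E M′ M i j ≡ Ext.I E i j)
  where

  open import Data.Empty using (⊥; ⊥-elim)
  open import Data.Fin using (Fin; zero; suc; splitAt; _↑ˡ_; _↑ʳ_)
  open import Data.Fin.Properties using (join-splitAt)
  open import Data.List using (map; allFin)
  open import Data.List.Membership.Propositional.Properties using (∈-map⁺; ∈-allFin)
  open import Data.List.Properties using (length-map; length-tabulate)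
  import Data.Nat as ℕ
  open import Data.Nat using (ℕ; zero; suc; _≤_; _<_; _≤?_; _<?_; _∸_; s≤s)
  import Data.Nat.Properties as ℕₚ
  open import Data.Nat.Properties using (<-irrefl; ≤-antisym; ≤-trans; ≤-pred; ≰⇒>; ≮⇒≥; m∸n+n≡m; <-≤-trans; +-monoˡ-<; +-monoˡ-≤; ≤-reflexive; <⇒≤)
  open import Data.Product using (∃; _×_; _,_; proj₁; proj₂)
  open import Data.Sum using (inj₁; inj₂)
  open import Data.Unit using (⊤; tt)
  open import Data.Vec.Functional using (_++_) renaming ([] to []ᶠ)
  open import Data.Vec.Functional.Properties using (lookup-++ˡ; lookup-++ʳ)
  open import Data.Vec.Functional.Relation.Unary.All.Properties using (++⁺)
  open import Function using (_∘_)
  open import Relation.Binary.PropositionalEquality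
  open import Relation.Nullary using (¬_; yes; no)
  open import Relation.Nullary.Decidable using (_×-dec_)
  open import Relation.Unary using (Decidable)
  open ≡-Reasoning

  open FieldExtension E
  open Ext E
  open Field Top
  open FieldProperties Top
  open LinearCombinations E
  open Subfield E finF finL
  module FS = FieldProperties.Sum Base
  open Kernels E finL

  U : Vec k → Set
  U = SystemOf G M

  U-resp : ∀ {x y} → x ≗ y → U x → U y
  U-resp x≗y (u , u∈ , x≡) = u , u∈ , λ j → trans (sym (x≗y j)) (x≡ j)

  U? : Decidable U
  U? x = Finiteness.∃-function? finL (λ u≗u′ (u∈ , x≡) → KS.Span-resp u≗u′ u∈ , λ j → trans (x≡ j) (ᵥ*-cong M u≗u′ j))
           (λ u → KS.Span? (columns G) u ×-dec Finiteness.≗? finL x (u ᵥ* M))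

  column : Fin n → Vec k
  column j = columns G j ᵥ* M

  column∈U : ∀ j → U (column j)
  column∈U j = columns G j , KS.Span-member (columns G) j , λ _ → refl

  ᵥ*M-injective : ∀ {u u′} → (u ᵥ* M) ≗ (u′ ᵥ* M) → u ≗ u′
  ᵥ*M-injective {u} {u′} uM≗u′M q = trans (sym (ᵥ*-inverse M M′ MM′≡I u q)) (trans (ᵥ*-cong M′ uM≗u′M q) (ᵥ*-inverse M M′ MM′≡I u′ q))

  kernel⇒dual : ∀ {v} → InKernel G v → Dual (CodeOf G) v
  kernel⇒dual {v} v∈ c (a , c≡) = begin
    ∑ (λ j → c j * v j)          ≡⟨ dot-cong c≡ (λ _ → refl) ⟩
    dot (lc a G) v               ≡⟨ dot-comm (lc a G) v ⟩
    dot v (lc a G)               ≡⟨ dot-lc v a G ⟩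
    ∑ (λ l → a l * dot v (G l))  ≡⟨ ∑-0 (λ l → trans (cong (a l *_) (trans (dot-comm v (G l)) (v∈ l))) (zeroʳ (a l))) ⟩
    0#                           ∎

  dual⇒kernel : ∀ {v} → Dual (CodeOf G) v → InKernel G v
  dual⇒kernel v∈ i = v∈ (G i) (LS.Span-member G i)

  -- Fewer than k vectors cannot L-span U: a nonzero vector orthogonal to their images under M⁻¹
  -- would be orthogonal to all columns of G, i.e. a relation among the rows of G.
  U-spans : ∀ {s} (Q : Fin s → Vec k) → LS.Independent Q → s < k → ¬ (∀ j → LS.Span Q (column j))
  U-spans {s} Q Q-ind s<k columns⊆Q with kernelBasis s Q′ Q′-ind
    where
    Q′ : Fin s → Vec k
    Q′ i = Q i ᵥ* M′
    Q′-ind : LS.Independent Q′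
    Q′-ind c rel = Q-ind c λ q → trans (sym (ᵥ*-inverse M′ M M′M≡I (lc c Q) q))
                                      (trans (ᵥ*-cong M (λ j → trans (lc-ᵥ* c Q M′ j) (rel j)) q) (0ᵥ* M q))
  ... | zero  , s+0≡k , _ = <-irrefl (trans (sym (ℕₚ.+-identityʳ s)) s+0≡k) s<k
  ... | suc t , _ , e , e∈ , e-ind , _ = LS.Independent⇒≢0 {b = e} e-ind zero (G-rows (e zero) e₀G≡0)
    where
    Q′ : Fin s → Vec k
    Q′ i = Q i ᵥ* M′
    e₀G≡0 : lc (e zero) G ≗ 0v
    e₀G≡0 j with columns⊆Q j
    ... | a , column≡ = begin
      ∑ (λ i → e zero i * G i j)               ≡⟨ ∑-cong (λ i → *-comm (e zero i) (G i j)) ⟩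
      dot (columns G j) (e zero)               ≡⟨ dot-cong (λ q → trans (sym (ᵥ*-inverse M M′ MM′≡I (columns G j) q))
                                                    (trans (ᵥ*-cong M′ column≡ q) (lc-ᵥ* a Q M′ q))) (λ _ → refl) ⟩
      dot (lc a Q′) (e zero)                   ≡⟨ trans (dot-comm (lc a Q′) (e zero)) (dot-lc (e zero) a Q′) ⟩
      ∑ (λ l → a l * dot (e zero) (Q′ l))      ≡⟨ ∑-0 (λ l → trans (cong (a l *_) (trans (dot-comm (e zero) (Q′ l)) (e∈ zero l))) (zeroʳ (a l))) ⟩
      0#                                       ∎

  dual-dimension : ∀ {K⊥} → LDim (Dual (CodeOf G)) K⊥ → k ℕ.+ K⊥ ≡ n
  dual-dimension {K⊥} (b , b∈ , b-ind , b-spans) with kernelBasis k G G-rows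
  ... | t , k+t≡n , e , e∈ , e-ind , e-spans = trans (cong (k ℕ.+_) (≤-antisym K⊥≤t t≤K⊥)) k+t≡n
    where
    t≤K⊥ : t ≤ K⊥
    t≤K⊥ = LS.steinitz K⊥ b e e-ind (λ l → b-spans (e l) (kernel⇒dual (e∈ l)))
    K⊥≤t : K⊥ ≤ t
    K⊥≤t = LS.steinitz t e b b-ind (λ i → e-spans (b i) (dual⇒kernel (b∈ i)))

  -- v = Σ cᵢ aᵢ, where aᵢ ∈ Fⁿ are the coordinates of Bᵢ over the columns; its entries lie in ⟨c⟩_F.
  relation⇒codeword : ∀ {s} (B : Fin s → Vec k) → (∀ i → U (B i)) → KS.Independent B →
                      (c : Fin s → Carrier) → lc c B ≗ 0v → (i : Fin s) → c i ≢ 0# →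
                      ∃ λ v → Dual (CodeOf G) v × ¬ (v ≗ 0v) × ∃ λ e → RankWeight v e × e ≤ s
  relation⇒codeword {s} B B∈U B-ind c rel i₀ c≢0 =
    v , kernel⇒dual v∈ , v≢0 , rankWeight≤ v (λ i _ → c i) (λ j → (λ i → a i j) , λ _ → ∑-cong (λ i → *-comm (c i) (A i j)))
    where
    a : Fin s → Fin n → F.Carrier
    a i = proj₁ (proj₁ (proj₂ (B∈U i)))
    A : Fin s → Vec n
    A i j = ι (a i j)
    B≡ : ∀ i → (lc (A i) (columns G) ᵥ* M) ≗ B i
    B≡ i q = sym (trans (proj₂ (proj₂ (B∈U i)) q) (ᵥ*-cong M (proj₂ (proj₁ (proj₂ (B∈U i)))) q))
    A-ind : KS.Independent A
    A-ind α rel-α = B-ind α λ q → begin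
      lc (ι ∘ α) B q                                       ≡⟨ lc-congʳ (ι ∘ α) (λ i → sym ∘ B≡ i) q ⟩
      lc (ι ∘ α) (λ i → lc (A i) (columns G) ᵥ* M) q       ≡⟨ sym (lc-ᵥ* (ι ∘ α) (λ i → lc (A i) (columns G)) M q) ⟩
      (lc (ι ∘ α) (λ i → lc (A i) (columns G)) ᵥ* M) q     ≡⟨ ᵥ*-cong M (λ q′ → trans (lc-lc (ι ∘ α) A (columns G) q′) (lc-zeroˡ (columns G) rel-α q′)) q ⟩
      (0v ᵥ* M) q                                          ≡⟨ 0ᵥ* M q ⟩
      0#                                                   ∎
    v : Vec n
    v = lc c A
    v∈ : InKernel G v
    v∈ l = begin
      dot (G l) (lc c A)                                   ≡⟨ dot-lc (G l) c A ⟩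
      ∑ (λ i → c i * dot (G l) (A i))                      ≡⟨ ∑-cong (λ i → cong (c i *_) (dot-comm (G l) (A i))) ⟩
      lc c (λ i → lc (A i) (columns G)) l                  ≡⟨ lc-congʳ c (λ i q → sym (ᵥ*-inverse M M′ MM′≡I _ q) ) l ⟩
      lc c (λ i → (lc (A i) (columns G) ᵥ* M) ᵥ* M′) l     ≡⟨ lc-congʳ c (λ i → ᵥ*-cong M′ (B≡ i)) l ⟩
      lc c (λ i → B i ᵥ* M′) l                             ≡⟨ sym (lc-ᵥ* c B M′ l) ⟩
      (lc c B ᵥ* M′) l                                     ≡⟨ trans (ᵥ*-cong M′ rel l) (0ᵥ* M′ l) ⟩
      0#                                                   ∎
    v≢0 : ¬ (v ≗ 0v)
    v≢0 v≡0 = c≢0 (independent⇒L-independent a A-ind c v≡0 i₀)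

  module _ {h d⊥ : ℕ} (d⊥-minimal : ∀ v r → Dual (CodeOf G) v → ¬ (v ≗ 0v) → RankWeight v r → d⊥ ≤ r)
           (h+2≤d⊥ : suc (suc h) ≤ d⊥) (w : Fin h → Vec k) (w-ind : LIndep w) where

    InW : Vec k → Set
    InW x = U x × LSpan w x

    InW? : Decidable InW
    InW? x = U? x ×-dec LS.Span? w x

    no-h+1-independent : ∀ {e} → e ≡ suc h → (B : Fin e → Vec k) → KS.Independent B → (∀ i → InW (B i)) → ⊥
    no-h+1-independent refl B B-ind B∈W with LS.independent-or-relation B
    ... | inj₁ B-L-ind = <-irrefl refl (LS.steinitz h w B B-L-ind (proj₂ ∘ B∈W))
    ... | inj₂ (c , rel , i , cᵢ≢0) =
      let v , v∈ , v≢0 , e , weight , e≤h+1 = relation⇒codeword B (proj₁ ∘ B∈W) B-ind c rel i cᵢ≢0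
      in <-irrefl refl (≤-trans h+2≤d⊥ (≤-trans (d⊥-minimal v e v∈ v≢0 weight) e≤h+1))

    bound⇒scattered : ∃ λ d → KDim InW d × d ≤ h
    bound⇒scattered = from-extension (KS.extend []ᶠ (λ _ _ ()) InW InW? (suc h) (Finiteness.functions finL k))
      where
      open KS.Extension
      from-extension : KS.Extension []ᶠ InW (suc h) (Finiteness.functions finL k) → ∃ λ d → KDim InW d × d ≤ h
      from-extension ext with saturated ext | size ext ≤? h
      ... | inj₁ size≡ | _          = ⊥-elim (no-h+1-independent size≡ (new ext) new-independent (new∈P ext))
        where new-independent = KS.Independent-++⁻ˡ (new ext) []ᶠ (independent ext)
      ... | inj₂ _     | no size≰h  = ⊥-elim (no-h+1-independent (≤-antisym (size≤bound ext) (≰⇒> size≰h)) (new ext) new-independent (new∈P ext))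
        where new-independent = KS.Independent-++⁻ˡ (new ext) []ᶠ (independent ext)
      ... | inj₂ sat   | yes size≤h = size ext , (new ext , new∈P ext , KS.Independent-++⁻ˡ (new ext) []ᶠ (independent ext) , spans) , size≤h
        where
        spans : ∀ x → InW x → KSpan (new ext) x
        spans x x∈W with Finiteness.functions-complete finL k x
        ... | y , y∈ , y≗x = KS.Span-resp y≗x (KS.Span-++[] (new ext) (sat y y∈ (U-resp (sym ∘ y≗x) (proj₁ x∈W) , LS.Span-resp (sym ∘ y≗x) (proj₂ x∈W))))

  -- xᵢ = (Σⱼ aⱼᵢ gⱼ) M, where aⱼ are the coordinates of vⱼ in b; then Σ bᵢ xᵢ = (Σⱼ vⱼ gⱼ) M = 0.
  codeword⇒relation : ∀ {D} (v : Vec n) → Dual (CodeOf G) v → (b : Fin D → Vec 1) →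
                      (∀ i → KSpan (entries v) (b i)) → KS.Independent b → (∀ j → KSpan b (entries v j)) →
                      ∃ λ (x : Fin D → Vec k) → (∀ i → U (x i)) × KS.Independent x × lc (λ i → b i zero) x ≗ 0v
  codeword⇒relation {D} v v∈ b b⊆ b-ind entries⊆b = x , x∈U , x-ind , rel
    where
    a : Fin n → Fin D → F.Carrier
    a j = proj₁ (entries⊆b j)
    y : Fin D → Vec k
    y i = lc (λ j → ι (a j i)) (columns G)
    x : Fin D → Vec k
    x i = y i ᵥ* M
    x∈U : ∀ i → U (x i)
    x∈U i = y i , ((λ j → a j i) , λ _ → refl) , λ _ → refl
    x-ind : KS.Independent x
    x-ind α rel-α = FS.left-inverse⇒injective a (λ l → proj₁ (b⊆ l)) BA≡I α aα≡0
      where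
      BA≡I : ∀ l i → FS.sum (λ j → proj₁ (b⊆ l) j F.* a j i) ≡ KS.SP.δ l i
      BA≡I = KS.change-of-basis b (entries v) b-ind a (proj₂ ∘ entries⊆b) (λ l → proj₁ (b⊆ l)) (λ l → proj₂ (b⊆ l))
      y-rel : lc (ι ∘ α) y ≗ 0v
      y-rel = ᵥ*M-injective λ q → trans (lc-ᵥ* (ι ∘ α) y M q) (trans (rel-α q) (sym (0ᵥ* M q)))
      aα≡0 : ∀ j → FS.sum (λ i → α i F.* a j i) ≡ F.0#
      aα≡0 = G-columns (λ j → FS.sum (λ i → α i F.* a j i)) λ q → begin
        lc (λ j → ι (FS.sum (λ i → α i F.* a j i))) (columns G) q         ≡⟨ lc-congˡ (columns G) (λ j → trans (KS.φ-sum (λ i → α i F.* a j i)) (∑-cong (λ i → ι-* (α i) (a j i)))) q ⟩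
        lc (λ j → ∑ (λ i → ι (α i) * ι (a j i))) (columns G) q           ≡⟨ sym (lc-lc (ι ∘ α) (λ i j → ι (a j i)) (columns G) q) ⟩
        lc (ι ∘ α) y q                                                   ≡⟨ y-rel q ⟩
        0#                                                               ∎
    rel : lc (λ i → b i zero) x ≗ 0v
    rel q = begin
      lc c x q                 ≡⟨ sym (lc-ᵥ* c y M q) ⟩
      (lc c y ᵥ* M) q          ≡⟨ ᵥ*-cong M y-rel q ⟩
      (0v ᵥ* M) q              ≡⟨ 0ᵥ* M q ⟩
      0#                       ∎
      where
      c : Fin D → Carrier
      c i = b i zero
      y-rel : lc c y ≗ 0v
      y-rel l = begin
        lc c y l                                             ≡⟨ lc-lc c (λ i j → ι (a j i)) (columns G) l ⟩
        lc (λ j → ∑ (λ i → c i * ι (a j i))) (columns G) l   ≡⟨ lc-congˡ (columns G) (λ j → trans (∑-cong (λ i → *-comm (c i) (ι (a j i)))) (sym (proj₂ (entries⊆b j) zero))) l ⟩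
        lc v (columns G) l                                   ≡⟨ ∑-cong (λ j → *-comm (v j) (G l j)) ⟩
        dot (G l) v                                          ≡⟨ dual⇒kernel v∈ l ⟩
        0#                                                   ∎

  -- The columns lie in U and span L^k, so this extension can only stop by reaching its bound.
  column-extension-full : ∀ {h ez} {z : Fin ez → Vec k} (e : LS.Extension z U (h ∸ ez) (map column (allFin n))) →
                          ez ≤ h → h < k → LS.Extension.size e ℕ.+ ez ≡ h
  column-extension-full {h} {ez} {z} e ez≤h h<k with saturated e | size e <? h ∸ ez
    where open LS.Extension
  ... | inj₁ size≡   | _          = trans (cong (ℕ._+ ez) size≡) (m∸n+n≡m ez≤h)
  ... | inj₂ _       | no  size≮  = trans (cong (ℕ._+ ez) (≤-antisym (LS.Extension.size≤bound e) (≮⇒≥ size≮))) (m∸n+n≡m ez≤h)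
  ... | inj₂ spans   | yes size<  = ⊥-elim (U-spans (new ++ z) independent size+ez<k
                                       (λ j → spans (column j) (∈-map⁺ column (∈-allFin j)) (column∈U j)))
    where
    open LS.Extension e using (size; new; independent)
    size+ez<k : size ℕ.+ ez < k
    size+ez<k = <-≤-trans (+-monoˡ-< ez size<) (≤-trans (≤-reflexive (m∸n+n≡m ez≤h)) (<⇒≤ h<k))

  independent-++ : ∀ {a b c} (x : Fin a → Vec k) (y : Fin b → Vec k) (z : Fin c → Vec k) → KS.Independent x →
                   (∀ i → LS.Span z (x i)) → LS.Independent (y ++ z) → KS.Independent (x ++ y)
  independent-++ {a} {b} {c} x y z x-ind x⊆z yz-ind C rel = C≡0
    where
    Cx : Fin a → Carrier
    Cx = ι ∘ C ∘ (_↑ˡ b)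
    Cy : Fin b → Carrier
    Cy = ι ∘ C ∘ (a ↑ʳ_)
    -- rewriting the xᵢ in terms of z turns rel into a relation among y ++ z
    Cz : Fin c → Carrier
    Cz m = ∑ (λ i → Cx i * proj₁ (x⊆z i) m)
    yz-rel : lc (Cy ++ Cz) (y ++ z) ≗ 0v
    yz-rel q = begin
      lc (Cy ++ Cz) (y ++ z) q                                   ≡⟨ LS.lc-++ (Cy ++ Cz) y z q ⟩
      lc (λ j → (Cy ++ Cz) (j ↑ˡ c)) y q + lc (λ m → (Cy ++ Cz) (b ↑ʳ m)) z q
        ≡⟨ cong₂ _+_ (lc-congˡ y (lookup-++ˡ Cy Cz) q) (lc-congˡ z (lookup-++ʳ Cy Cz) q) ⟩
      lc Cy y q + lc Cz z q                                      ≡⟨ cong (lc Cy y q +_) (sym (lc-lc Cx (λ i → proj₁ (x⊆z i)) z q)) ⟩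
      lc Cy y q + lc Cx (λ i → lc (proj₁ (x⊆z i)) z) q           ≡⟨ cong (lc Cy y q +_) (sym (lc-congʳ Cx (proj₂ ∘ x⊆z) q)) ⟩
      lc Cy y q + lc Cx x q                                      ≡⟨ +-comm _ _ ⟩
      lc Cx x q + lc Cy y q                                      ≡⟨ sym (KS.lc-++ (ι ∘ C) x y q) ⟩
      lc (ι ∘ C) (x ++ y) q                                      ≡⟨ rel q ⟩
      0#                                                         ∎
    Cy≡0 : ∀ j → C (a ↑ʳ j) ≡ F.0#
    Cy≡0 j = KS.φ≡0⇒≡0 _ (trans (sym (lookup-++ˡ Cy Cz j)) (yz-ind (Cy ++ Cz) yz-rel (j ↑ˡ c)))
    x-rel : lc Cx x ≗ 0v
    x-rel q = begin
      lc Cx x q                                   ≡⟨ sym (+-identityʳ _) ⟩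
      lc Cx x q + 0#                              ≡⟨ cong (lc Cx x q +_) (sym (lc-zeroˡ y (λ j → trans (cong ι (Cy≡0 j)) KS.φ-0) q)) ⟩
      lc Cx x q + lc Cy y q                       ≡⟨ sym (KS.lc-++ (ι ∘ C) x y q) ⟩
      lc (ι ∘ C) (x ++ y) q                       ≡⟨ rel q ⟩
      0#                                          ∎
    C≡0 : ∀ i → C i ≡ F.0#
    C≡0 i with splitAt a i | join-splitAt a b i
    ... | inj₁ i′ | refl = x-ind (C ∘ (_↑ˡ b)) x-rel i′
    ... | inj₂ j  | refl = Cy≡0 j

  scattered-bound : ∀ {h m r} → HScattered U h → (W : Fin m → Vec k) → m ≡ h → LIndep W →
                    (X : Fin r → Vec k) → KS.Independent X → (∀ i → U (X i) × LSpan W (X i)) → r ≤ h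
  scattered-bound scattered W refl W-ind X X-ind X⊆ with scattered W W-ind
  ... | d , (β , _ , _ , β-spans) , d≤h = ≤-trans (KS.steinitz d β X X-ind (λ i → β-spans (X i) (X⊆ i))) d≤h

  -- D = d'+1 F-independent but L-dependent points of U span an L-space of dimension ≤ d'; completing
  -- a basis of it by columns to an h-space W puts d' + 1 + (h − dim) > h F-independent points in U ∩ W.
  relation⇒not-scattered : ∀ {h d′} → h < k → HScattered U h → (x : Fin (suc d′) → Vec k) → (∀ i → U (x i)) →
                           KS.Independent x → LS.Span (x ∘ suc) (x zero) → d′ ≤ h → ⊥
  relation⇒not-scattered {h} {d′} h<k scattered x x∈U x-ind x₀∈ d′≤h =
    <-irrefl refl (≤-trans h<d′+1+ey (scattered-bound scattered (y ++ z) ey+ez≡h yz-ind (x ++ y) xy-ind xy⊆))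
    where
    open LS.BasisOf (LS.basisOf (λ _ → ⊤) (λ _ → yes tt) (map (x ∘ suc) (allFin d′)))
      renaming (size to ez; basis to z; independent to z-ind; size≤length to ez≤length)
    x⊆z : ∀ i → LS.Span z (x i)
    x⊆z (suc i) = spans (x (suc i)) (∈-map⁺ (x ∘ suc) (∈-allFin i)) tt
    x⊆z zero    = LS.Span-trans (x⊆z ∘ suc) x₀∈
    ez≤d′ : ez ≤ d′
    ez≤d′ = ≤-trans ez≤length (≤-reflexive (trans (length-map (x ∘ suc) (allFin d′)) (length-tabulate (λ i → i))))
    completion : LS.Extension z U (h ∸ ez) (map column (allFin n))
    completion = LS.extend z z-ind U U? (h ∸ ez) (map column (allFin n))
    open LS.Extension completion using () renaming (size to ey; new to y; new∈P to y∈U; independent to yz-ind)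
    ey+ez≡h : ey ℕ.+ ez ≡ h
    ey+ez≡h = column-extension-full completion (≤-trans ez≤d′ d′≤h) h<k
    xy-ind : KS.Independent (x ++ y)
    xy-ind = independent-++ x y z x-ind x⊆z yz-ind
    xy⊆ : ∀ i → U ((x ++ y) i) × LSpan (y ++ z) ((x ++ y) i)
    xy⊆ = ++⁺ (λ v → U v × LSpan (y ++ z) v) (λ i → x∈U i , LS.Span-++⁺ʳ y z (x⊆z i))
                                              (λ j → y∈U j , LS.Span-++⁺ˡ y z (LS.Span-member y j))
    h<d′+1+ey : h < suc d′ ℕ.+ ey
    h<d′+1+ey = s≤s (≤-trans (≤-reflexive (trans (sym ey+ez≡h) (ℕₚ.+-comm ey ez))) (+-monoˡ-≤ ey ez≤d′))

  scattered⇒bound : ∀ {h d⊥} → h < k → HScattered U h → MinRankDist (Dual (CodeOf G)) d⊥ → suc (suc h) ≤ d⊥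
  scattered⇒bound {h} {d⊥} h<k scattered ((v , v∈ , v≢0 , b , b⊆ , b-ind , b-spans) , _) with suc (suc h) ≤? d⊥
  ... | yes h+2≤d⊥ = h+2≤d⊥
  ... | no  h+2≰d⊥ = ⊥-elim (low-weight b b⊆ b-ind (λ j → b-spans (entries v j) (KS.Span-member (entries v) j)) (≤-pred (≰⇒> h+2≰d⊥)))
    where
    low-weight : ∀ {D} (b : Fin D → Vec 1) → (∀ i → KSpan (entries v) (b i)) → KS.Independent b →
                 (∀ j → KSpan b (entries v j)) → D ≤ suc h → ⊥
    low-weight {zero}   b _  _     entries⊆b _   = v≢0 λ j → proj₂ (entries⊆b j) zero
    low-weight {suc d′} b b⊆ b-ind entries⊆b D≤h+1 =
      let x , x∈U , x-ind , rel = codeword⇒relation v v∈ b b⊆ b-ind entries⊆b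
          b₀≢0 = λ b₀≡0 → KS.Independent⇒≢0 {b = b} b-ind zero λ { zero → b₀≡0 }
      in relation⇒not-scattered h<k scattered x x∈U x-ind (LS.Span-solve b₀≢0 (λ i → b (suc i) zero) (x ∘ suc) rel) (≤-pred D≤h+1)

module SingletonDefect where

  import Data.Integer as ℤ
  open import Data.Integer using (+_) renaming (_≤_ to _≤ℤ_; _+_ to _+ℤ_; _-_ to _-ℤ_)
  import Data.Integer.Properties as ℤ
  import Data.Integer.Tactic.RingSolver as ℤ-Solver
  import Data.Nat as ℕ
  open import Data.Nat using (ℕ; suc; _≤_; _<_; _∸_; _*_; s≤s)
  open import Data.Nat.DivMod using (_/_; _%_; m≡m%n+[m/n]*n; m%n<n; +-distrib-/-∣ʳ; m<n⇒m/n≡0; m*n/n≡m; /-monoˡ-≤)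
  open import Data.Nat.Divisibility using (divides)
  open import Data.Nat.Properties
  import Data.Nat.Tactic.RingSolver as ℕ-Solver
  open import Function using (_⇔_; mk⇔)
  open import Relation.Binary.PropositionalEquality

  module _ (m k K n′ : ℕ) (k+K≡n : k ℕ.+ K ≡ suc n′) where

    private
      n Q R : ℕ
      n = suc n′
      Q = (k * m) / n
      R = (k * m) % n

    floor≤m : Q ≤ m
    floor≤m = ≤-trans (/-monoˡ-≤ n (*-monoˡ-≤ m (subst (k ≤_) k+K≡n (m≤m+n k K)))) (≤-reflexive (trans (cong (_/ n) (*-comm n m)) (m*n/n≡m m n)))

    -- ⌈(n − k) m / n⌉ = m − ⌊k m / n⌋, since (n−k) m + (n−1) = (m − Q) n + (n − 1 − R) with n − 1 − R < n
    ceil-complement : ceilDiv (K * m) n ≡ m ∸ Q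
    ceil-complement = begin
      (K * m ℕ.+ n′) / n                         ≡⟨ cong (_/ n) split ⟩
      ((n′ ∸ R) ℕ.+ (m ∸ Q) * n) / n             ≡⟨ +-distrib-/-∣ʳ (n′ ∸ R) (divides (m ∸ Q) refl) ⟩
      (n′ ∸ R) / n ℕ.+ ((m ∸ Q) * n) / n         ≡⟨ cong₂ ℕ._+_ (m<n⇒m/n≡0 (s≤s (m∸n≤m n′ R))) (m*n/n≡m (m ∸ Q) n) ⟩
      m ∸ Q                                      ∎
      where
      open ≡-Reasoning
      R≤n′ : R ≤ n′
      R≤n′ = ≤-pred (m%n<n (k * m) n)
      regroup : ∀ K m n′ k → (K * m ℕ.+ n′) ℕ.+ k * m ≡ (k ℕ.+ K) * m ℕ.+ n′
      regroup = ℕ-Solver.solve-∀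
      interchange : ∀ a b c d → (a ℕ.+ b) ℕ.+ (c ℕ.+ d) ≡ (a ℕ.+ c) ℕ.+ (b ℕ.+ d)
      interchange = ℕ-Solver.solve-∀
      split : K * m ℕ.+ n′ ≡ (n′ ∸ R) ℕ.+ (m ∸ Q) * n
      split = +-cancelʳ-≡ (R ℕ.+ Q * n) _ _ (begin
        (K * m ℕ.+ n′) ℕ.+ (R ℕ.+ Q * n)              ≡⟨ cong ((K * m ℕ.+ n′) ℕ.+_) (sym (m≡m%n+[m/n]*n (k * m) n)) ⟩
        (K * m ℕ.+ n′) ℕ.+ k * m                      ≡⟨ regroup K m n′ k ⟩
        (k ℕ.+ K) * m ℕ.+ n′                          ≡⟨ cong (λ t → t * m ℕ.+ n′) k+K≡n ⟩
        n * m ℕ.+ n′                                  ≡⟨ trans (+-comm (n * m) n′) (cong (n′ ℕ.+_) (*-comm n m)) ⟩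
        n′ ℕ.+ m * n                                  ≡⟨ sym (cong₂ ℕ._+_ (m∸n+n≡m R≤n′) (trans (sym (*-distribʳ-+ n (m ∸ Q) Q)) (cong (_* n) (m∸n+n≡m floor≤m)))) ⟩
        ((n′ ∸ R) ℕ.+ R) ℕ.+ ((m ∸ Q) * n ℕ.+ Q * n)  ≡⟨ interchange (n′ ∸ R) R ((m ∸ Q) * n) (Q * n) ⟩
        ((n′ ∸ R) ℕ.+ (m ∸ Q) * n) ℕ.+ (R ℕ.+ Q * n)  ∎)

    Rdef≤⇔ : ∀ h d → (Rdef m n K d ≤ℤ ((+ Q -ℤ + h) -ℤ + 1)) ⇔ (suc (suc h) ≤ d)
    Rdef≤⇔ h d = mk⇔ (λ le → ℤ.drop‿+≤+ (ℤ.i-j≤0⇒i≤j (subst (_≤ℤ + 0) difference (ℤ.i≤j⇒i-j≤0 le))))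
                     (λ le → ℤ.i-j≤0⇒i≤j (subst (_≤ℤ + 0) (sym difference) (ℤ.i≤j⇒i-j≤0 (ℤ.+≤+ le))))
      where
      m-ceil≡Q : + m -ℤ + ceilDiv (K * m) n ≡ + Q
      m-ceil≡Q = trans (cong (λ c → + m -ℤ + c) ceil-complement)
                       (trans (ℤ.[+m]-[+n]≡m⊖n m (m ∸ Q)) (trans (ℤ.⊖-≥ (m∸n≤m m Q)) (cong +_ (m∸[m∸n]≡n floor≤m))))
      difference : Rdef m n K d -ℤ ((+ Q -ℤ + h) -ℤ + 1) ≡ + suc (suc h) -ℤ + d
      difference = trans (cong (λ x → ((x -ℤ + d) +ℤ + 1) -ℤ ((+ Q -ℤ + h) -ℤ + 1)) m-ceil≡Q)
                         (trans (identity (+ Q) (+ d) (+ h)) (cong (λ t → + t -ℤ + d) (+-comm h 2)))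
        where
        identity : ∀ q d h → ((q -ℤ d) +ℤ + 1) -ℤ ((q -ℤ h) -ℤ + 1) ≡ (h +ℤ + 2) -ℤ d
        identity = ℤ-Solver.solve-∀

open import Data.Nat using (ℕ; suc; _≤_; _<_; _^_; _*_; _/_; NonZero)
open import Data.Integer using (+_; _-_) renaming (_≤_ to _≤ℤ_)
open import Data.Product using (_,_; proj₂)
open import Function.Bundles using (_⇔_; mk⇔)
import Function.Properties.Equivalence as ⇔
open SingletonDefect using (Rdef≤⇔)

theorem6p2 : (q m k n h : ℕ) → .{{_ : NonZero n}} →
    IsPrimePower q → 1 ≤ m → 1 ≤ k → k < n → h < k →
    (E : FieldExtension) →
    HasSize (Field.Carrier (FieldExtension.Base E)) q →
    HasSize (Field.Carrier (FieldExtension.Top E)) (q ^ m) →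
    (G : Ext.Mat E k n) →
    Ext.LDim E (Ext.CodeOf E G) k →
    Ext.KDim E (Ext.KSpan E (Ext.columns E G)) n →
    (M : Ext.Mat E k k) → Ext.Invertible E M →
    (K⊥ d⊥ : ℕ) →
    Ext.LDim E (Ext.Dual E (Ext.CodeOf E G)) K⊥ →
    Ext.MinRankDist E (Ext.Dual E (Ext.CodeOf E G)) d⊥ →
    (Ext.HScattered E (Ext.SystemOf E G M) h
    ⇔ (Rdef m n K⊥ d⊥ ≤ℤ ((+ ((k * m) / n) - + h) - + 1)))
theorem6p2 q m k (suc n′) h _ _ _ k<n h<k E F-size L-size G (b , b∈C , b-ind , _) (c , c∈ , c-ind , _)
           M (M′ , MM′≡I , M′M≡I) K⊥ d⊥ dual-dim min-dist =
  ⇔.trans (mk⇔ (λ scattered → scattered⇒bound h<k scattered min-dist) (bound⇒scattered (proj₂ min-dist))) (⇔.sym (Rdef≤⇔ m k K⊥ n′ (dual-dimension dual-dim) h d⊥))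
  where
  finF : Finiteness.Finite (Field.Carrier (FieldExtension.Base E))
  finF = Finiteness.hasSize⇒finite F-size
  finL : Finiteness.Finite (Field.Carrier (FieldExtension.Top E))
  finL = Finiteness.hasSize⇒finite L-size
  open Subfield E finF finL using (module KS; module LS)
  G-rows : Ext.LIndep E G
  G-rows = LS.independent-in-span⇒independent G b b-ind b∈C
  G-columns : Ext.KIndep E (Ext.columns E G)
  G-columns = KS.independent-in-span⇒independent (Ext.columns E G) c c-ind c∈
  open System E finF finL G G-rows G-columns M M′ MM′≡I M′M≡I
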